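{- Let $C = A \sqcup B$ be a disjoint union of finite sets of integers. For each $u \in \mathfrak{S}_A$ and $v \in \mathfrak{S}_B$, one has the following expansion: \[ F^{\mathrm{cyc}}_{|A|,\mathrm{cDes}(u)} \cdot F^{\mathrm{cyc}}_{|B|,\mathrm{cDes}(v)} = \sum_{[w] \in [u] \,\sqcup\!\sqcup_{\mathrm{cyc}}\, [v] } F^{\mathrm{cyc}}_{|C|,\mathrm{cDes}(w)}. \]
   Context: For a finite set $A$ of size $a$, $\mathfrak{S}_A$ is the set of bijections $u:[a]\to A$, viewed as words $u=(u_1,\ldots,u_a)$. For a finite set of integers $A$ and $u\in\mathfrak{S}_A$, the cyclic descent set is $\mathrm{cDes}(u):=\{1\le i\le a : u_i>u_{i+1}\}$ with the convention $u_{a+1}:=u_1$; for $|A|\le 1$ one sets $\mathrm{cDes}(u):=\varnothing$. The cyclic class $[u]$ is the equivalence class of $u$ under cyclic rotations $(u_1,\ldots,u_a)\sim(u_{i+1},\ldots,u_a,u_1,\ldots,u_i)$; $\mathrm{cDes}(w)$ depends on $[w]$ only up to cyclic shift, and $F^{\mathrm{cyc}}_{n,J}$ is invariant under cyclic shifts of $J$. For disjoint $A,B$, a cyclic shuffle of $[u]$ and $[v]$ is a class $[w]$, $w\in\mathfrak{S}_{A\sqcup B}$, having a representative that is a shuffle (i.e., contains both as subwords) of some cyclic shift of $u$ and some cyclic shift of $v$; $[u]\,\sqcup\!\sqcup_{\mathrm{cyc}}\,[v]$ denotes the set of all such cyclic shuffles. For $n\ge1$ and $J\subseteq[n]$, the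 fundamental cyclic quasi-symmetric function is $F^{\mathrm{cyc}}_{n,J}:=\sum x_{w_1}x_{w_2}\cdots x_{w_n}$, summed over all pairs $(w,k)$ with $w=(w_1,\ldots,w_n)$ a word of positive integers and $k\in[n]$ such that (i) $w_k\le w_{k+1}\le\cdots\le w_n\le w_1\le\cdots\le w_{k-1}$, and (ii) for every $j\in J\setminus\{k-1\}$, $w_j<w_{j+1}$ (indices modulo $n$). Also $F^{\mathrm{cyc}}_{0,\varnothing}:=1$. -}

module Defs where

open import Data.Nat using (ℕ; zero; suc; _+_; _*_; _∸_; _≤_; _≤ᵇ_; _<ᵇ_; _≡ᵇ_)
open import Data.Integer using (ℤ)
import Data.Integer as ℤ
open import Data.Bool using (Bool; true; false; if_then_else_; _∧_; _∨_; not)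
open import Data.List using (List; []; _∷_; _++_; length; map; concatMap; drop; take; zipWith; upTo)
open import Data.Nat.ListAction using (sum)
open import Data.Product using (Σ; ∃; _×_; _,_)
open import Relation.Nullary using (does)
open import Relation.Binary.PropositionalEquality using (_≡_)

nth : {A : Set} → A → List A → ℕ → A
nth d []       _       = d
nth d (x ∷ xs) zero    = x
nth d (x ∷ xs) (suc i) = nth d xs i

-- w_j for j ∈ [n] (1-based)
at : {A : Set} → A → List A → ℕ → A
at d w j = nth d w (j ∸ 1)

range1 : ℕ → List ℕ
range1 n = map suc (upTo n)

nxt : ℕ → ℕ → ℕ
nxt n j = if j ≡ᵇ n then 1 else suc j

rotate : {A : Set} → ℕ → List A → List A
rotate i xs = drop i xs ++ take i xs

allB : {A : Set} → (A → Bool) → List A → Bool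
allB p []       = true
allB p (x ∷ xs) = p x ∧ allB p xs

anyB : {A : Set} → (A → Bool) → List A → Bool
anyB p []       = false
anyB p (x ∷ xs) = p x ∨ anyB p xs

filterB : {A : Set} → (A → Bool) → List A → List A
filterB p []       = []
filterB p (x ∷ xs) = if p x then x ∷ filterB p xs else filterB p xs

count : {A : Set} → (A → Bool) → List A → ℕ
count p []       = 0
count p (x ∷ xs) = (if p x then 1 else 0) + count p xs

-- Cyclic descent set of a word of integers (as a list of positions in [a]).

cDes : List ℤ → List ℕ
cDes []           = []
cDes (x ∷ [])     = []
cDes u@(_ ∷ _ ∷ _) =
  filterB (λ i → does (at (ℤ.+ 0) u (nxt (length u) i) ℤ.<? at (ℤ.+ 0) u i))
         (range1 (length u))

-- Formal power series in x_1, x_2, … with ℕ coefficients.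
-- A monomial x_1^{α_1} ⋯ x_L^{α_L} is given by its exponent list
-- α = (α_1,…,α_L) (trailing zeros are irrelevant for all series below).

Series : Set
Series = List ℕ → ℕ

_≈ˢ_ : Series → Series → Set
F ≈ˢ G = ∀ α → F α ≡ G α

infix 4 _≈ˢ_

below : List ℕ → List (List ℕ)
below []      = [] ∷ []
below (a ∷ α) = concatMap (λ b → map (b ∷_) (below α)) (upTo (suc a))

_*ˢ_ : Series → Series → Series
(F *ˢ G) α = sum (map (λ β → F β * G (zipWith _∸_ α β)) (below α))

infixl 7 _*ˢ_

0ˢ : Series
0ˢ _ = 0

_+ˢ_ : Series → Series → Series
(F +ˢ G) α = F α + G α

sumˢ : List Series → Series
sumˢ []       = 0ˢ
sumˢ (F ∷ Fs) = F +ˢ sumˢ Fs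

words : ℕ → ℕ → List (List ℕ)
words zero    L = [] ∷ []
words (suc n) L = concatMap (λ a → map (a ∷_) (words n L)) (range1 L)

-- the word w has content α, i.e. x_{w_1}⋯x_{w_n} = x^α
-- (letters of w are taken in {1,…,length α})
hasContent : List ℕ → List ℕ → Bool
hasContent α w =
  allB (λ i → count (λ c → c ≡ᵇ i) w ≡ᵇ at 0 α i) (range1 (length α))

weaklyIncreasing : List ℕ → Bool
weaklyIncreasing []           = true
weaklyIncreasing (x ∷ [])     = true
weaklyIncreasing (x ∷ y ∷ xs) = (x ≤ᵇ y) ∧ weaklyIncreasing (y ∷ xs)

allZero : List ℕ → Bool
allZero = allB (λ a → a ≡ᵇ 0)

-- condition on a pair (w,k) in the definition of F^cyc_{n,J}:
-- (i)  w_k ≤ … ≤ w_n ≤ w_1 ≤ … ≤ w_{k-1}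
-- (ii) w_j < w_{j+1} for j ∈ J, j ≢ k-1 (mod n), indices mod n
cycCond : ℕ → List ℕ → List ℕ → ℕ → Bool
cycCond n J w k =
  weaklyIncreasing (rotate (k ∸ 1) w) ∧
  allB (λ j → if anyB (λ x → x ≡ᵇ j) J ∧ not (nxt n j ≡ᵇ k)
              then at 0 w j <ᵇ at 0 w (nxt n j) else true)
       (range1 n)

-- Fundamental cyclic quasi-symmetric function F^cyc_{n,J}:
-- coefficient of x^α = number of pairs (w,k) with content(w) = α,
-- k ∈ [n], satisfying (i) and (ii).  F^cyc_{0,∅} = 1.
Fcyc : ℕ → List ℕ → Series
Fcyc zero    J α = if allZero α then 1 else 0
Fcyc (suc n) J α =
  sum (map (λ w → count (cycCond (suc n) J w) (range1 (suc n)))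
           (filterB (λ w → hasContent α w) (words (suc n) (length α))))

data Shuffle {A : Set} : List A → List A → List A → Set where
  []    : Shuffle [] [] []
  left  : ∀ {x xs ys zs} → Shuffle xs ys zs → Shuffle (x ∷ xs) ys (x ∷ zs)
  right : ∀ {y xs ys zs} → Shuffle xs ys zs → Shuffle xs (y ∷ ys) (y ∷ zs)

CycShift : {A : Set} → List A → List A → Set
CycShift xs ys = Σ ℕ (λ i → i ≤ length xs × ys ≡ rotate i xs)

-- [w] ∈ [u] ⧢_cyc [v]: some cyclic shift of w is a shuffle of some
-- cyclic shift of u and some cyclic shift of v
IsCycShuffle : List ℤ → List ℤ → List ℤ → Set
IsCycShuffle u v w =
  Σ (List ℤ) λ w' → Σ (List ℤ) λ u' → Σ (List ℤ) λ v' →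
    CycShift w w' × CycShift u u' × CycShift v v' × Shuffle u' v' w'

-- A biletter is a pair (letter , label) ∈ ℕ × ℤ, ordered
-- lexicographically; the standardization std P of a list P of biletters is the list of labels of P
-- after sorting P.  For a word x of distinct labels and a word w with |w| = |x|, a pair (w,k) is
-- counted by F^cyc_{|x|,cDes x} exactly when the (k-1)-st rotation of zip w x is strictly increasing;
-- this holds for at most one k, and for some k iff std (zip w x) is a cyclic shift of x.  Hence
--   (★)  [x^α] F^cyc_{|x|,cDes x} = #{ w : content w = α, std (zip w x) ∈ [x] }.
-- By (★) the coefficient of x^α on the left becomes a sum over words w labelled by c = u ++ v of
-- [content w = α]·[std P|u ∈ [u]]·[std P|v ∈ [v]], where P = zip w c and P|u keeps the biletters
-- labelled in u (so that std P|u = (std P)|u).  On the right, each representative r is a rearrangement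
-- of c and the count (★) is invariant under permuting labels, so it becomes the sum over the same
-- words of [content w = α]·Σ_{r ∈ R} [std P ∈ [r]].  The integrands agree: an arrangement o of c is
-- a cyclic shuffle of [u] and [v] iff o|u ∈ [u] and o|v ∈ [v], and R is a transversal of these classes.
module Submission where

open import Defs
open import Algebra.Bundles using (CommutativeMonoid)
open import Algebra.Properties.CommutativeSemigroup using (interchange)
open import Data.Bool using (Bool; true; false; if_then_else_; _∧_; _∨_; not; T)
open import Data.Bool.Properties using (∧-zeroʳ; ∧-identityʳ; ∧-commutativeMonoid)
open import Data.Empty using (⊥-elim)
open import Data.Integer using (ℤ)
import Data.Integer as ℤ
import Data.Integer.Properties as ℤ
open import Data.List using (List; []; _∷_; _++_; length; map; concatMap; drop; take; zip; zipWith; upTo; applyUpTo)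
open import Data.List.Properties
  using (∷-injectiveˡ; ∷-injectiveʳ; ≡-dec; ++-assoc; ++-identityʳ; upTo-∷ʳ; length-++; length-map; map-++; map-∘;
         take-map; drop-map; length-drop; length-zipWith; take++drop≡id; take-all; drop-all; length-applyUpTo)
open import Data.List.Membership.Propositional using (_∈_; _∉_; find)
open import Data.List.Membership.Propositional.Properties using (∈-++⁻; ∈-map⁺)
open import Data.List.Relation.Binary.Disjoint.Propositional using (Disjoint)
open import Data.List.Relation.Binary.Permutation.Propositional using (_↭_; prep; swap; ↭-sym; ↭⇒↭ₛ)
  renaming (refl to ↭-refl; trans to ↭-trans)
open import Data.List.Relation.Binary.Permutation.Propositional.Properties
  using (∈-resp-↭; drop-∷; All-resp-↭; ++-comm; ++⁺; ↭-length; shift) renaming (map⁺ to ↭-map⁺)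
import Data.List.Relation.Binary.Permutation.Setoid.Properties as PermutationSetoid
open import Data.List.Relation.Unary.All as All using (All; []; _∷_)
import Data.List.Relation.Unary.All.Properties as AllP
open import Data.List.Relation.Unary.AllPairs using (AllPairs; []; _∷_)
open import Data.List.Relation.Unary.Any using (Any; here; there)
open import Data.List.Relation.Unary.Unique.Propositional using (Unique)
import Data.List.Relation.Unary.Unique.Propositional.Properties as Unique
open import Data.Nat using (ℕ; zero; suc; _+_; _*_; _∸_; _⊓_; _≤_; _<_; z≤n; s≤s; _≤ᵇ_; _<ᵇ_; _≡ᵇ_)
open import Data.Nat.ListAction using (sum)
open import Data.Nat.Properties
open import Data.Product using (Σ; _×_; _,_; proj₁; proj₂)
open import Data.Sum using (_⊎_; inj₁; inj₂)
open import Relation.Binary.Definitions using (tri<; tri≈; tri>)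
open import Relation.Binary.PropositionalEquality
  using (setoid; _≡_; _≢_; refl; sym; trans; cong; cong₂; subst; subst₂; module ≡-Reasoning)
open import Relation.Nullary using (¬_; Dec; yes; no; does)

-- Finite sums indexed by lists

∑ : {A : Set} → (A → ℕ) → List A → ℕ
∑ f xs = sum (map f xs)

∑-cong : {A : Set} {f g : A → ℕ} (xs : List A) → (∀ x → f x ≡ g x) → ∑ f xs ≡ ∑ g xs
∑-cong []       e = refl
∑-cong (x ∷ xs) e = cong₂ _+_ (e x) (∑-cong xs e)

∑-congᴬ : {A : Set} {f g : A → ℕ} {xs : List A} → All (λ x → f x ≡ g x) xs → ∑ f xs ≡ ∑ g xs
∑-congᴬ []       = refl
∑-congᴬ (e ∷ es) = cong₂ _+_ e (∑-congᴬ es)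

∑-++ : {A : Set} (f : A → ℕ) (xs ys : List A) → ∑ f (xs ++ ys) ≡ ∑ f xs + ∑ f ys
∑-++ f []       ys = refl
∑-++ f (x ∷ xs) ys = trans (cong (f x +_) (∑-++ f xs ys)) (sym (+-assoc (f x) _ _))

∑-+ : {A : Set} (f g : A → ℕ) (xs : List A) → ∑ (λ x → f x + g x) xs ≡ ∑ f xs + ∑ g xs
∑-+ f g []       = refl
∑-+ f g (x ∷ xs) = trans (cong (f x + g x +_) (∑-+ f g xs))
                         (interchange +-commutativeSemigroup (f x) (g x) (∑ f xs) (∑ g xs))

∑-zero : {A : Set} (xs : List A) → ∑ (λ _ → 0) xs ≡ 0
∑-zero []       = refl
∑-zero (x ∷ xs) = ∑-zero xs

∑-*ˡ : {A : Set} (c : ℕ) (f : A → ℕ) (xs : List A) → ∑ (λ x → c * f x) xs ≡ c * ∑ f xs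
∑-*ˡ c f []       = sym (*-zeroʳ c)
∑-*ˡ c f (x ∷ xs) = trans (cong (c * f x +_) (∑-*ˡ c f xs)) (sym (*-distribˡ-+ c (f x) (∑ f xs)))

∑-*ʳ : {A : Set} (c : ℕ) (f : A → ℕ) (xs : List A) → ∑ (λ x → f x * c) xs ≡ ∑ f xs * c
∑-*ʳ c f []       = refl
∑-*ʳ c f (x ∷ xs) = trans (cong (f x * c +_) (∑-*ʳ c f xs)) (sym (*-distribʳ-+ c (f x) (∑ f xs)))

∑-map : {A B : Set} (f : B → ℕ) (h : A → B) (xs : List A) → ∑ f (map h xs) ≡ ∑ (λ x → f (h x)) xs
∑-map f h []       = refl
∑-map f h (x ∷ xs) = cong (f (h x) +_) (∑-map f h xs)

∑-concatMap : {A B : Set} (f : B → ℕ) (g : A → List B) (xs : List A) →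
  ∑ f (concatMap g xs) ≡ ∑ (λ x → ∑ f (g x)) xs
∑-concatMap f g []       = refl
∑-concatMap f g (x ∷ xs) = trans (∑-++ f (g x) (concatMap g xs)) (cong (∑ f (g x) +_) (∑-concatMap f g xs))

∑-swap : {A B : Set} (f : A → B → ℕ) (xs : List A) (ys : List B) →
  ∑ (λ a → ∑ (λ b → f a b) ys) xs ≡ ∑ (λ b → ∑ (λ a → f a b) xs) ys
∑-swap f []       ys = sym (∑-zero ys)
∑-swap f (x ∷ xs) ys = trans (cong (∑ (λ b → f x b) ys +_) (∑-swap f xs ys))
                             (sym (∑-+ (λ b → f x b) (λ b → ∑ (λ a → f a b) xs) ys))

∑-product : {A B : Set} (f : A → ℕ) (g : B → ℕ) (xs : List A) (ys : List B) →
  ∑ f xs * ∑ g ys ≡ ∑ (λ x → ∑ (λ y → f x * g y) ys) xs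
∑-product f g xs ys = trans (sym (∑-*ʳ (∑ g ys) f xs)) (∑-cong xs (λ x → sym (∑-*ˡ (f x) g ys)))

∑-filterB : {A : Set} (p : A → Bool) (f : A → ℕ) (xs : List A) →
  ∑ f (filterB p xs) ≡ ∑ (λ x → if p x then f x else 0) xs
∑-filterB p f []       = refl
∑-filterB p f (x ∷ xs) with p x
... | true  = cong (f x +_) (∑-filterB p f xs)
... | false = ∑-filterB p f xs

χ : Bool → ℕ
χ b = if b then 1 else 0

if-χ : (b : Bool) (n : ℕ) → (if b then n else 0) ≡ χ b * n
if-χ true  n = sym (+-identityʳ n)
if-χ false n = refl

χ-∧ : ∀ a b → χ (a ∧ b) ≡ χ a * χ b
χ-∧ true  b = sym (+-identityʳ (χ b))
χ-∧ false b = refl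

sumˢ-map : {A : Set} (F : A → Series) (R : List A) (α : List ℕ) → sumˢ (map F R) α ≡ ∑ (λ r → F r α) R
sumˢ-map F []      α = refl
sumˢ-map F (r ∷ R) α = cong (F r α +_) (sumˢ-map F R α)

bool-ext : (a b : Bool) → (a ≡ true → b ≡ true) → (b ≡ true → a ≡ true) → a ≡ b
bool-ext true  true  f g = refl
bool-ext true  false f g = sym (f refl)
bool-ext false true  f g = g refl
bool-ext false false f g = refl

∧-true : ∀ {a b} → a ∧ b ≡ true → a ≡ true × b ≡ true
∧-true {true} {true} _ = refl , refl

∧-intro : ∀ {a b} → a ≡ true → b ≡ true → a ∧ b ≡ true
∧-intro refl refl = refl

∨-elimˡ : ∀ {a b} → a ≡ false → a ∨ b ≡ true → b ≡ true
∨-elimˡ {false} _ h = h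

≡ᵇ-true : ∀ m n → (m ≡ᵇ n) ≡ true → m ≡ n
≡ᵇ-true m n e = ≡ᵇ⇒≡ m n (subst T (sym e) _)

≡ᵇ-refl : ∀ m n → m ≡ n → (m ≡ᵇ n) ≡ true
≡ᵇ-refl m n e with m ≡ᵇ n | ≡⇒≡ᵇ m n e
... | true | _ = refl

≡ᵇ-false : ∀ m n → (m ≡ᵇ n) ≡ false → m ≢ n
≡ᵇ-false m n e m≡n with trans (sym (≡ᵇ-refl m n m≡n)) e
... | ()

≢⇒≡ᵇ-false : ∀ m n → m ≢ n → (m ≡ᵇ n) ≡ false
≢⇒≡ᵇ-false m n m≢n with m ≡ᵇ n in eq
... | true  = ⊥-elim (m≢n (≡ᵇ-true m n eq))
... | false = refl

≤ᵇ-true : ∀ m n → (m ≤ᵇ n) ≡ true → m ≤ n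
≤ᵇ-true m n e = ≤ᵇ⇒≤ m n (subst T (sym e) _)

≤ᵇ-false : ∀ m n → (m ≤ᵇ n) ≡ false → ¬ m ≤ n
≤ᵇ-false m n e m≤n = subst T e (≤⇒≤ᵇ m≤n)

≤⇒≤ᵇ-true : ∀ m n → m ≤ n → (m ≤ᵇ n) ≡ true
≤⇒≤ᵇ-true m n m≤n with m ≤ᵇ n in e
... | true  = refl
... | false = ⊥-elim (≤ᵇ-false m n e m≤n)

anyB-upTo⁻ : (p : ℕ → Bool) (f : ℕ → ℕ) (N : ℕ) → anyB p (applyUpTo f N) ≡ true →
  Σ ℕ λ i → i < N × p (f i) ≡ true
anyB-upTo⁻ p f (suc N) h with p (f 0) in eq
... | true  = 0 , s≤s z≤n , eq
... | false with anyB-upTo⁻ p (λ i → f (suc i)) N h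
...   | i , i<N , e = suc i , s≤s i<N , e

anyB-upTo⁺ : (p : ℕ → Bool) (f : ℕ → ℕ) (N i : ℕ) → i < N → p (f i) ≡ true → anyB p (applyUpTo f N) ≡ true
anyB-upTo⁺ p f (suc N) zero    _         e rewrite e = refl
anyB-upTo⁺ p f (suc N) (suc i) (s≤s i<N) e with p (f 0)
... | true  = refl
... | false = anyB-upTo⁺ p (λ i → f (suc i)) N i i<N e

allB-range⁻ : (p : ℕ → Bool) (f : ℕ → ℕ) (N : ℕ) → allB p (map suc (applyUpTo f N)) ≡ true →
  ∀ q → q < N → p (suc (f q)) ≡ true
allB-range⁻ p f (suc N) h zero    _         = proj₁ (∧-true {p (suc (f 0))} h)
allB-range⁻ p f (suc N) h (suc q) (s≤s q<N) = allB-range⁻ p (λ i → f (suc i)) N (proj₂ (∧-true {p (suc (f 0))} h)) q q<N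

allB-range⁺ : (p : ℕ → Bool) (f : ℕ → ℕ) (N : ℕ) → (∀ q → q < N → p (suc (f q)) ≡ true) →
  allB p (map suc (applyUpTo f N)) ≡ true
allB-range⁺ p f zero    h = refl
allB-range⁺ p f (suc N) h = ∧-intro (h 0 (s≤s z≤n)) (allB-range⁺ p (λ i → f (suc i)) N (λ q q<N → h (suc q) (s≤s q<N)))

allB-nth⁻ : (p : ℕ → Bool) (β : List ℕ) → allB p β ≡ true → ∀ q → q < length β → p (nth 0 β q) ≡ true
allB-nth⁻ p (b ∷ β) h zero    _         = proj₁ (∧-true {p b} h)
allB-nth⁻ p (b ∷ β) h (suc q) (s≤s q<n) = allB-nth⁻ p β (proj₂ (∧-true {p b} h)) q q<n

allB-nth⁺ : (p : ℕ → Bool) (β : List ℕ) → (∀ q → q < length β → p (nth 0 β q) ≡ true) → allB p β ≡ true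
allB-nth⁺ p []      h = refl
allB-nth⁺ p (b ∷ β) h = ∧-intro (h 0 (s≤s z≤n)) (allB-nth⁺ p β (λ q q<n → h (suc q) (s≤s q<n)))

allB-∧ : {A : Set} (p q : A → Bool) (xs : List A) → allB p xs ∧ allB q xs ≡ allB (λ x → p x ∧ q x) xs
allB-∧ p q []       = refl
allB-∧ p q (x ∷ xs) with p x | q x
... | true  | true  = allB-∧ p q xs
... | true  | false = ∧-zeroʳ (allB p xs)
... | false | _     = refl

allB-cong : {A : Set} (p q : A → Bool) (xs : List A) → (∀ x → p x ≡ q x) → allB p xs ≡ allB q xs
allB-cong p q []       h = refl
allB-cong p q (x ∷ xs) h = cong₂ _∧_ (h x) (allB-cong p q xs h)

allB-cong-range : (p q : ℕ → Bool) (f : ℕ → ℕ) (N : ℕ) → (∀ i → i < N → p (suc (f i)) ≡ q (suc (f i))) →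
  allB p (map suc (applyUpTo f N)) ≡ allB q (map suc (applyUpTo f N))
allB-cong-range p q f zero    h = refl
allB-cong-range p q f (suc N) h =
  cong₂ _∧_ (h 0 (s≤s z≤n)) (allB-cong-range p q (λ i → f (suc i)) N (λ i i<N → h (suc i) (s≤s i<N)))

count-cong-range : (p q : ℕ → Bool) (f : ℕ → ℕ) (N : ℕ) → (∀ i → i < N → p (suc (f i)) ≡ q (suc (f i))) →
  count p (map suc (applyUpTo f N)) ≡ count q (map suc (applyUpTo f N))
count-cong-range p q f zero    h = refl
count-cong-range p q f (suc N) h =
  cong₂ (λ a b → χ a + b) (h 0 (s≤s z≤n)) (count-cong-range p q (λ i → f (suc i)) N (λ i i<N → h (suc i) (s≤s i<N)))

count-map : {A B : Set} (p : B → Bool) (f : A → B) (xs : List A) → count p (map f xs) ≡ count (λ x → p (f x)) xs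
count-map p f []       = refl
count-map p f (x ∷ xs) = cong (χ (p (f x)) +_) (count-map p f xs)

count-++ : {A : Set} (p : A → Bool) (xs ys : List A) → count p (xs ++ ys) ≡ count p xs + count p ys
count-++ p []       ys = refl
count-++ p (x ∷ xs) ys = trans (cong (χ (p x) +_) (count-++ p xs ys)) (sym (+-assoc (χ (p x)) (count p xs) (count p ys)))

count-↭ : {A : Set} (p : A → Bool) {xs ys : List A} → xs ↭ ys → count p xs ≡ count p ys
count-↭ p ↭-refl         = refl
count-↭ p (prep x xs↭ys) = cong (χ (p x) +_) (count-↭ p xs↭ys)
count-↭ p (swap {xs} {ys} x y xs↭ys) = begin
  χ (p x) + (χ (p y) + count p xs)  ≡⟨ sym (+-assoc (χ (p x)) (χ (p y)) _) ⟩
  χ (p x) + χ (p y) + count p xs    ≡⟨ cong (_+ count p xs) (+-comm (χ (p x)) (χ (p y))) ⟩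
  χ (p y) + χ (p x) + count p xs    ≡⟨ +-assoc (χ (p y)) (χ (p x)) _ ⟩
  χ (p y) + (χ (p x) + count p xs)  ≡⟨ cong (λ t → χ (p y) + (χ (p x) + t)) (count-↭ p xs↭ys) ⟩
  χ (p y) + (χ (p x) + count p ys)  ∎
  where open ≡-Reasoning
count-↭ p (↭-trans xs↭ys ys↭zs) = trans (count-↭ p xs↭ys) (count-↭ p ys↭zs)

count-none : (p : ℕ → Bool) (f : ℕ → ℕ) (N : ℕ) → (∀ i → i < N → p (f i) ≡ false) → count p (applyUpTo f N) ≡ 0
count-none p f zero    h = refl
count-none p f (suc N) h rewrite h 0 (s≤s z≤n) = count-none p (λ i → f (suc i)) N (λ i i<N → h (suc i) (s≤s i<N))

count-atMostOne : (p : ℕ → Bool) (f : ℕ → ℕ) (N : ℕ) →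
  (∀ i j → i < N → j < N → p (f i) ≡ true → p (f j) ≡ true → i ≡ j) →
  count p (applyUpTo f N) ≡ χ (anyB p (applyUpTo f N))
count-atMostOne p f zero    unique = refl
count-atMostOne p f (suc N) unique with p (f 0) in eq
... | true  = cong suc (count-none p (λ i → f (suc i)) N noneAfter)
  where
  noneAfter : ∀ i → i < N → p (f (suc i)) ≡ false
  noneAfter i i<N with p (f (suc i)) in eq′
  ... | false = refl
  ... | true with unique 0 (suc i) (s≤s z≤n) (s≤s i<N) eq eq′
  ...   | ()
... | false = count-atMostOne p (λ i → f (suc i)) N
                (λ i j i<N j<N pi pj → suc-injective (unique (suc i) (suc j) (s≤s i<N) (s≤s j<N) pi pj))

words-length : (n L : ℕ) → All (λ w → length w ≡ n) (words n L)
words-length zero    L = refl ∷ []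
words-length (suc n) L = extend (range1 L)
  where
  extend : (as : List ℕ) → All (λ w → length w ≡ suc n) (concatMap (λ a → map (a ∷_) (words n L)) as)
  extend []       = []
  extend (a ∷ as) = AllP.++⁺ (AllP.map⁺ (All.map (cong suc) (words-length n L))) (extend as)

∑-words-suc : (n L : ℕ) (F : List ℕ → ℕ) →
  ∑ F (words (suc n) L) ≡ ∑ (λ c → ∑ (λ w → F (c ∷ w)) (words n L)) (range1 L)
∑-words-suc n L F = trans (∑-concatMap F (λ c → map (c ∷_) (words n L)) (range1 L))
                          (∑-cong (range1 L) (λ c → ∑-map F (c ∷_) (words n L)))

∑-words-+ : (a b L : ℕ) (G : List ℕ → ℕ) →
  ∑ G (words (a + b) L) ≡ ∑ (λ w₁ → ∑ (λ w₂ → G (w₁ ++ w₂)) (words b L)) (words a L)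
∑-words-+ zero    b L G = sym (+-identityʳ _)
∑-words-+ (suc a) b L G = begin
  ∑ G (words (suc a + b) L)
    ≡⟨ ∑-words-suc (a + b) L G ⟩
  ∑ (λ c → ∑ (λ w → G (c ∷ w)) (words (a + b) L)) (range1 L)
    ≡⟨ ∑-cong (range1 L) (λ c → ∑-words-+ a b L (λ w → G (c ∷ w))) ⟩
  ∑ (λ c → ∑ (λ w₁ → ∑ (λ w₂ → G (c ∷ w₁ ++ w₂)) (words b L)) (words a L)) (range1 L)
    ≡⟨ sym (∑-words-suc a L _) ⟩
  ∑ (λ w₁ → ∑ (λ w₂ → G (w₁ ++ w₂)) (words b L)) (words (suc a) L)
    ∎
  where open ≡-Reasoning

∑-words-cong : {f g : List ℕ → ℕ} (n L : ℕ) → (∀ w → length w ≡ n → f w ≡ g w) → ∑ f (words n L) ≡ ∑ g (words n L)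
∑-words-cong n L h = ∑-congᴬ (All.map (λ {w} → h w) (words-length n L))

length-zipWith-≡ : {A B C : Set} (f : A → B → C) (xs : List A) (ys : List B) → length xs ≡ length ys →
  length (zipWith f xs ys) ≡ length xs
length-zipWith-≡ f xs ys e = trans (length-zipWith f xs ys) (trans (cong (length xs ⊓_) (sym e)) (⊓-idem (length xs)))

contentVec : ℕ → List ℕ → List ℕ
contentVec L w = map (λ i → count (λ c → c ≡ᵇ i) w) (range1 L)

eqListᵇ : List ℕ → List ℕ → Bool
eqListᵇ []       []       = true
eqListᵇ (x ∷ xs) (y ∷ ys) = (x ≡ᵇ y) ∧ eqListᵇ xs ys
eqListᵇ _        _        = false

eqListᵇ-true : ∀ xs ys → eqListᵇ xs ys ≡ true → xs ≡ ys
eqListᵇ-true []       []       _ = refl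
eqListᵇ-true (x ∷ xs) (y ∷ ys) h =
  cong₂ _∷_ (≡ᵇ-true x y (proj₁ (∧-true {x ≡ᵇ y} h))) (eqListᵇ-true xs ys (proj₂ (∧-true {x ≡ᵇ y} h)))

eqListᵇ-refl : ∀ xs → eqListᵇ xs xs ≡ true
eqListᵇ-refl []       = refl
eqListᵇ-refl (x ∷ xs) = ∧-intro (≡ᵇ-refl x x refl) (eqListᵇ-refl xs)

eqListᵇ-sym : ∀ xs ys → eqListᵇ xs ys ≡ eqListᵇ ys xs
eqListᵇ-sym xs ys = bool-ext _ _
  (λ h → subst (λ t → eqListᵇ t xs ≡ true) (eqListᵇ-true xs ys h) (eqListᵇ-refl xs))
  (λ h → subst (λ t → eqListᵇ t ys ≡ true) (eqListᵇ-true ys xs h) (eqListᵇ-refl ys))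

length-contentVec : (L : ℕ) (w : List ℕ) → length (contentVec L w) ≡ L
length-contentVec L w = begin
  length (map (λ i → count (λ c → c ≡ᵇ i) w) (map suc (upTo L)))  ≡⟨ cong length (sym (map-∘ (upTo L))) ⟩
  length (map (λ i → count (λ c → c ≡ᵇ suc i) w) (upTo L))        ≡⟨ length-map _ (upTo L) ⟩
  length (upTo L)                                                  ≡⟨ length-applyUpTo _ L ⟩
  L                                                                ∎
  where open ≡-Reasoning

nth-contentVec : (L q : ℕ) (w : List ℕ) → q < L → nth 0 (contentVec L w) q ≡ count (λ c → c ≡ᵇ suc q) w
nth-contentVec L q w q<L = trans (cong (λ t → nth 0 t q) (sym (map-∘ (upTo L)))) (nth-range L q q<L)
  where
  nth-range : ∀ {g : ℕ → ℕ} {f : ℕ → ℕ} N q → q < N → nth 0 (map g (applyUpTo f N)) q ≡ g (f q)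
  nth-range (suc N) zero    _         = refl
  nth-range {g} {f} (suc N) (suc q) (s≤s q<N) = nth-range {g} {λ i → f (suc i)} N q q<N

nth-ext : (xs ys : List ℕ) → length xs ≡ length ys → (∀ q → q < length xs → nth 0 xs q ≡ nth 0 ys q) → xs ≡ ys
nth-ext []       []       _ _ = refl
nth-ext (x ∷ xs) (y ∷ ys) e h = cong₂ _∷_ (h 0 (s≤s z≤n)) (nth-ext xs ys (suc-injective e) (λ q q<n → h (suc q) (s≤s q<n)))

hasContent≡contentVec : (β w : List ℕ) → hasContent β w ≡ eqListᵇ (contentVec (length β) w) β
hasContent≡contentVec β w = bool-ext _ _ to from
  where
  L = length β
  p : ℕ → Bool
  p i = count (λ c → c ≡ᵇ i) w ≡ᵇ at 0 β i
  to : hasContent β w ≡ true → eqListᵇ (contentVec L w) β ≡ true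
  to h = subst (λ t → eqListᵇ t β ≡ true) (sym (nth-ext (contentVec L w) β (length-contentVec L w) entries)) (eqListᵇ-refl β)
    where
    entries : ∀ q → q < length (contentVec L w) → nth 0 (contentVec L w) q ≡ nth 0 β q
    entries q q<n = let q<L = subst (q <_) (length-contentVec L w) q<n in
      trans (nth-contentVec L q w q<L) (≡ᵇ-true _ _ (allB-range⁻ p (λ i → i) L h q q<L))
  from : eqListᵇ (contentVec L w) β ≡ true → hasContent β w ≡ true
  from h = allB-range⁺ p (λ i → i) L (λ q q<L → ≡ᵇ-refl _ _
    (trans (sym (nth-contentVec L q w q<L)) (cong (λ t → nth 0 t q) (eqListᵇ-true (contentVec L w) β h))))

contentVec-++ : (L : ℕ) (w₁ w₂ : List ℕ) → contentVec L (w₁ ++ w₂) ≡ zipWith _+_ (contentVec L w₁) (contentVec L w₂)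
contentVec-++ L w₁ w₂ = addEach (range1 L)
  where
  addEach : ∀ is → map (λ i → count (λ c → c ≡ᵇ i) (w₁ ++ w₂)) is
                   ≡ zipWith _+_ (map (λ i → count (λ c → c ≡ᵇ i) w₁) is) (map (λ i → count (λ c → c ≡ᵇ i) w₂) is)
  addEach []       = refl
  addEach (i ∷ is) = cong₂ _∷_ (count-++ (λ c → c ≡ᵇ i) w₁ w₂) (addEach is)

hasContent-↭ : (α : List ℕ) {w w′ : List ℕ} → w ↭ w′ → hasContent α w ≡ hasContent α w′
hasContent-↭ α w↭w′ = allB-cong _ _ (range1 (length α)) (λ i → cong (λ t → t ≡ᵇ at 0 α i) (count-↭ (λ c → c ≡ᵇ i) w↭w′))

hasContent-[] : (β : List ℕ) → hasContent β [] ≡ allZero β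
hasContent-[] β = bool-ext _ _
  (λ h → allB-nth⁺ (λ a → a ≡ᵇ 0) β (λ q q<L →
     trans (sym (0≡ᵇ (nth 0 β q))) (allB-range⁻ (λ i → 0 ≡ᵇ at 0 β i) (λ i → i) (length β) h q q<L)))
  (λ h → allB-range⁺ (λ i → 0 ≡ᵇ at 0 β i) (λ i → i) (length β) (λ q q<L →
     trans (0≡ᵇ (nth 0 β q)) (allB-nth⁻ (λ a → a ≡ᵇ 0) β h q q<L)))
  where
  0≡ᵇ : ∀ a → (0 ≡ᵇ a) ≡ (a ≡ᵇ 0)
  0≡ᵇ zero    = refl
  0≡ᵇ (suc a) = refl

leListᵇ : List ℕ → List ℕ → Bool
leListᵇ []      []      = true
leListᵇ (c ∷ γ) (a ∷ α) = (c ≤ᵇ a) ∧ leListᵇ γ α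
leListᵇ _       _       = false

below-length : (α : List ℕ) → All (λ β → length β ≡ length α) (below α)
below-length []      = refl ∷ []
below-length (a ∷ α) = extend (upTo (suc a))
  where
  extend : (bs : List ℕ) → All (λ β → length β ≡ suc (length α)) (concatMap (λ b → map (b ∷_) (below α)) bs)
  extend []       = []
  extend (b ∷ bs) = AllP.++⁺ (AllP.map⁺ (All.map (cong suc) (below-length α))) (extend bs)

∑-upTo-point : (a c : ℕ) (h : ℕ → ℕ) → ∑ (λ b → χ (b ≡ᵇ c) * h b) (upTo (suc a)) ≡ χ (c ≤ᵇ a) * h c
∑-upTo-point zero    zero    h = +-identityʳ (h 0 + 0)
∑-upTo-point zero    (suc c) h = refl
∑-upTo-point (suc a) c       h = begin
  ∑ term (upTo (suc (suc a)))                        ≡⟨ cong (∑ term) (sym (upTo-∷ʳ (suc a))) ⟩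
  ∑ term (upTo (suc a) ++ suc a ∷ [])                ≡⟨ ∑-++ term (upTo (suc a)) (suc a ∷ []) ⟩
  ∑ term (upTo (suc a)) + (term (suc a) + 0)         ≡⟨ cong₂ _+_ (∑-upTo-point a c h) (+-identityʳ _) ⟩
  χ (c ≤ᵇ a) * h c + χ (suc a ≡ᵇ c) * h (suc a)      ≡⟨ lastStep ⟩
  χ (c ≤ᵇ suc a) * h c                               ∎
  where
  open ≡-Reasoning
  term : ℕ → ℕ
  term b = χ (b ≡ᵇ c) * h b
  -- c ≤ a + 1 iff either c ≤ a or c = a + 1, and not both.
  lastStep : χ (c ≤ᵇ a) * h c + χ (suc a ≡ᵇ c) * h (suc a) ≡ χ (c ≤ᵇ suc a) * h c
  lastStep with c ≤ᵇ a in e₁ | suc a ≡ᵇ c in e₂ | c ≤ᵇ suc a in e₃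
  ... | true  | false | true  = +-identityʳ _
  ... | false | true  | true  = cong (λ t → h t + 0) (≡ᵇ-true (suc a) c e₂)
  ... | false | false | false = refl
  ... | true  | _     | false = ⊥-elim (≤ᵇ-false c (suc a) e₃ (m≤n⇒m≤1+n (≤ᵇ-true c a e₁)))
  ... | true  | true  | _     = ⊥-elim (<-irrefl (sym (≡ᵇ-true (suc a) c e₂)) (s≤s (≤ᵇ-true c a e₁)))
  ... | false | true  | false = ⊥-elim (≤ᵇ-false c (suc a) e₃ (≤-reflexive (sym (≡ᵇ-true (suc a) c e₂))))
  ... | false | false | true with m≤n⇒m<n∨m≡n (≤ᵇ-true c (suc a) e₃)
  ...   | inj₁ c<1+a = ⊥-elim (≤ᵇ-false c a e₁ (≤-pred c<1+a))
  ...   | inj₂ c≡1+a = ⊥-elim (≡ᵇ-false (suc a) c e₂ (sym c≡1+a))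

∑-below-point : (α γ : List ℕ) → length γ ≡ length α → (g : List ℕ → ℕ) →
  ∑ (λ β → χ (eqListᵇ β γ) * g β) (below α) ≡ χ (leListᵇ γ α) * g γ
∑-below-point []      []      e g = +-identityʳ _
∑-below-point (a ∷ α) (c ∷ γ) e g = begin
  ∑ (λ β → χ (eqListᵇ β (c ∷ γ)) * g β) (concatMap (λ b → map (b ∷_) (below α)) (upTo (suc a)))
    ≡⟨ ∑-concatMap _ (λ b → map (b ∷_) (below α)) (upTo (suc a)) ⟩
  ∑ (λ b → ∑ (λ β → χ (eqListᵇ β (c ∷ γ)) * g β) (map (b ∷_) (below α))) (upTo (suc a))
    ≡⟨ ∑-cong (upTo (suc a)) firstLetter ⟩
  ∑ (λ b → χ (b ≡ᵇ c) * (χ (leListᵇ γ α) * g (b ∷ γ))) (upTo (suc a))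
    ≡⟨ ∑-upTo-point a c (λ b → χ (leListᵇ γ α) * g (b ∷ γ)) ⟩
  χ (c ≤ᵇ a) * (χ (leListᵇ γ α) * g (c ∷ γ))
    ≡⟨ sym (*-assoc (χ (c ≤ᵇ a)) _ _) ⟩
  χ (c ≤ᵇ a) * χ (leListᵇ γ α) * g (c ∷ γ)
    ≡⟨ cong (_* g (c ∷ γ)) (sym (χ-∧ (c ≤ᵇ a) (leListᵇ γ α))) ⟩
  χ (leListᵇ (c ∷ γ) (a ∷ α)) * g (c ∷ γ)
    ∎
  where
  open ≡-Reasoning
  firstLetter : ∀ b → ∑ (λ β → χ (eqListᵇ β (c ∷ γ)) * g β) (map (b ∷_) (below α))
                      ≡ χ (b ≡ᵇ c) * (χ (leListᵇ γ α) * g (b ∷ γ))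
  firstLetter b = begin
    ∑ (λ β → χ (eqListᵇ β (c ∷ γ)) * g β) (map (b ∷_) (below α))   ≡⟨ ∑-map _ (b ∷_) (below α) ⟩
    ∑ (λ β → χ ((b ≡ᵇ c) ∧ eqListᵇ β γ) * g (b ∷ β)) (below α)
      ≡⟨ ∑-cong (below α) (λ β → trans (cong (_* g (b ∷ β)) (χ-∧ (b ≡ᵇ c) (eqListᵇ β γ))) (*-assoc (χ (b ≡ᵇ c)) _ _)) ⟩
    ∑ (λ β → χ (b ≡ᵇ c) * (χ (eqListᵇ β γ) * g (b ∷ β))) (below α)  ≡⟨ ∑-*ˡ (χ (b ≡ᵇ c)) _ (below α) ⟩
    χ (b ≡ᵇ c) * ∑ (λ β → χ (eqListᵇ β γ) * g (b ∷ β)) (below α)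
      ≡⟨ cong (χ (b ≡ᵇ c) *_) (∑-below-point α γ (suc-injective e) (λ β → g (b ∷ β))) ⟩
    χ (b ≡ᵇ c) * (χ (leListᵇ γ α) * g (b ∷ γ))                    ∎

eqListᵇ-+ : (γ₁ γ₂ α : List ℕ) → length γ₁ ≡ length α → length γ₂ ≡ length α →
  eqListᵇ (zipWith _+_ γ₁ γ₂) α ≡ leListᵇ γ₁ α ∧ eqListᵇ (zipWith _∸_ α γ₁) γ₂
eqListᵇ-+ []        []        []      _  _  = refl
eqListᵇ-+ (c₁ ∷ γ₁) (c₂ ∷ γ₂) (a ∷ α) e₁ e₂ =
  trans (cong₂ _∧_ (entry c₁ c₂ a) (eqListᵇ-+ γ₁ γ₂ α (suc-injective e₁) (suc-injective e₂)))
        (interchange (CommutativeMonoid.commutativeSemigroup ∧-commutativeMonoid)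
                     (c₁ ≤ᵇ a) (a ∸ c₁ ≡ᵇ c₂) (leListᵇ γ₁ α) (eqListᵇ (zipWith _∸_ α γ₁) γ₂))
  where
  entry : (c₁ c₂ a : ℕ) → (c₁ + c₂ ≡ᵇ a) ≡ (c₁ ≤ᵇ a) ∧ (a ∸ c₁ ≡ᵇ c₂)
  entry c₁ c₂ a = bool-ext _ _
    (λ h → let e = ≡ᵇ-true (c₁ + c₂) a h in
      ∧-intro (≤⇒≤ᵇ-true c₁ a (subst (c₁ ≤_) e (m≤m+n c₁ c₂)))
              (≡ᵇ-refl (a ∸ c₁) c₂ (trans (cong (_∸ c₁) (sym e)) (m+n∸m≡n c₁ c₂))))
    (λ h → let (c₁≤a , d) = ∧-true {c₁ ≤ᵇ a} h in
      ≡ᵇ-refl _ _ (trans (cong (c₁ +_) (sym (≡ᵇ-true _ _ d))) (m+[n∸m]≡n (≤ᵇ-true c₁ a c₁≤a))))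

content-convolution : (α w₁ w₂ : List ℕ) →
  ∑ (λ β → χ (hasContent β w₁) * χ (hasContent (zipWith _∸_ α β) w₂)) (below α) ≡ χ (hasContent α (w₁ ++ w₂))
content-convolution α w₁ w₂ = begin
  ∑ (λ β → χ (hasContent β w₁) * χ (hasContent (zipWith _∸_ α β) w₂)) (below α)
    ≡⟨ ∑-congᴬ (All.map (λ {β} → asVectors β) (below-length α)) ⟩
  ∑ (λ β → χ (eqListᵇ β γ₁) * χ (eqListᵇ (zipWith _∸_ α β) γ₂)) (below α)
    ≡⟨ ∑-below-point α γ₁ (length-contentVec L w₁) (λ β → χ (eqListᵇ (zipWith _∸_ α β) γ₂)) ⟩
  χ (leListᵇ γ₁ α) * χ (eqListᵇ (zipWith _∸_ α γ₁) γ₂)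
    ≡⟨ sym (χ-∧ (leListᵇ γ₁ α) _) ⟩
  χ (leListᵇ γ₁ α ∧ eqListᵇ (zipWith _∸_ α γ₁) γ₂)
    ≡⟨ cong χ (sym (eqListᵇ-+ γ₁ γ₂ α (length-contentVec L w₁) (length-contentVec L w₂))) ⟩
  χ (eqListᵇ (zipWith _+_ γ₁ γ₂) α)
    ≡⟨ cong (λ t → χ (eqListᵇ t α)) (sym (contentVec-++ L w₁ w₂)) ⟩
  χ (eqListᵇ (contentVec L (w₁ ++ w₂)) α)
    ≡⟨ cong χ (sym (hasContent≡contentVec α (w₁ ++ w₂))) ⟩
  χ (hasContent α (w₁ ++ w₂))
    ∎
  where
  open ≡-Reasoning
  L = length α
  γ₁ = contentVec L w₁
  γ₂ = contentVec L w₂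
  asContent : (β w : List ℕ) → length β ≡ L → hasContent β w ≡ eqListᵇ β (contentVec L w)
  asContent β w e = trans (hasContent≡contentVec β w)
                          (trans (cong (λ n → eqListᵇ (contentVec n w) β) e) (eqListᵇ-sym (contentVec L w) β))
  asVectors : ∀ β → length β ≡ L →
    χ (hasContent β w₁) * χ (hasContent (zipWith _∸_ α β) w₂) ≡ χ (eqListᵇ β γ₁) * χ (eqListᵇ (zipWith _∸_ α β) γ₂)
  asVectors β e = cong₂ _*_ (cong χ (asContent β w₁ e))
                            (cong χ (asContent (zipWith _∸_ α β) w₂ (length-zipWith-≡ _∸_ α β (sym e))))

PermInvariant : {A : Set} → (List A → ℕ) → Set
PermInvariant {A} Φ = ∀ {P Q : List A} → P ↭ Q → Φ P ≡ Φ Q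

-- Σ_w Φ (zip w x), over words w with |w| = |x|, depends only on the multiset of labels x: permuting x
-- permutes the positions of the letters of w, which is a bijection of the set of words.
∑-relabel : {K : Set} (L : ℕ) (Φ : List (ℕ × K) → ℕ) → PermInvariant Φ → {x y : List K} → x ↭ y →
  ∑ (λ w → Φ (zip w x)) (words (length x) L) ≡ ∑ (λ w → Φ (zip w y)) (words (length y) L)
∑-relabel L Φ inv ↭-refl = refl
∑-relabel L Φ inv (prep {xs} {ys} z xs↭ys) = begin
  ∑ (λ w → Φ (zip w (z ∷ xs))) (words (suc (length xs)) L)
    ≡⟨ ∑-words-suc (length xs) L _ ⟩
  ∑ (λ c → ∑ (λ w → Φ ((c , z) ∷ zip w xs)) (words (length xs) L)) (range1 L)
    ≡⟨ ∑-cong (range1 L) (λ c → ∑-relabel L (λ P → Φ ((c , z) ∷ P)) (λ p → inv (prep _ p)) xs↭ys) ⟩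
  ∑ (λ c → ∑ (λ w → Φ ((c , z) ∷ zip w ys)) (words (length ys) L)) (range1 L)
    ≡⟨ sym (∑-words-suc (length ys) L _) ⟩
  ∑ (λ w → Φ (zip w (z ∷ ys))) (words (suc (length ys)) L)
    ∎
  where open ≡-Reasoning
∑-relabel L Φ inv (swap {xs} {ys} z₁ z₂ xs↭ys) = begin
  ∑ (λ w → Φ (zip w (z₁ ∷ z₂ ∷ xs))) (words (2 + length xs) L)
    ≡⟨ twoLetters xs z₁ z₂ ⟩
  ∑ (λ c → ∑ (λ d → ∑ (λ w → Φ ((c , z₁) ∷ (d , z₂) ∷ zip w xs)) (words (length xs) L)) (range1 L)) (range1 L)
    ≡⟨ ∑-swap _ (range1 L) (range1 L) ⟩
  ∑ (λ d → ∑ (λ c → ∑ (λ w → Φ ((c , z₁) ∷ (d , z₂) ∷ zip w xs)) (words (length xs) L)) (range1 L)) (range1 L)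
    ≡⟨ ∑-cong (range1 L) (λ d → ∑-cong (range1 L) (λ c → swapped c d)) ⟩
  ∑ (λ d → ∑ (λ c → ∑ (λ w → Φ ((d , z₂) ∷ (c , z₁) ∷ zip w ys)) (words (length ys) L)) (range1 L)) (range1 L)
    ≡⟨ sym (twoLetters ys z₂ z₁) ⟩
  ∑ (λ w → Φ (zip w (z₂ ∷ z₁ ∷ ys))) (words (2 + length ys) L)
    ∎
  where
  open ≡-Reasoning
  twoLetters : ∀ zs y₁ y₂ → ∑ (λ w → Φ (zip w (y₁ ∷ y₂ ∷ zs))) (words (2 + length zs) L)
    ≡ ∑ (λ c → ∑ (λ d → ∑ (λ w → Φ ((c , y₁) ∷ (d , y₂) ∷ zip w zs)) (words (length zs) L)) (range1 L)) (range1 L)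
  twoLetters zs y₁ y₂ = trans (∑-words-suc (suc (length zs)) L _) (∑-cong (range1 L) (λ c → ∑-words-suc (length zs) L _))
  swapped : ∀ c d → ∑ (λ w → Φ ((c , z₁) ∷ (d , z₂) ∷ zip w xs)) (words (length xs) L)
                  ≡ ∑ (λ w → Φ ((d , z₂) ∷ (c , z₁) ∷ zip w ys)) (words (length ys) L)
  swapped c d = trans (∑-relabel L (λ P → Φ ((c , z₁) ∷ (d , z₂) ∷ P)) (λ p → inv (prep _ (prep _ p))) xs↭ys)
                      (∑-cong (words (length ys) L) (λ w → inv (swap _ _ ↭-refl)))
∑-relabel L Φ inv (↭-trans p q) = trans (∑-relabel L Φ inv p) (∑-relabel L Φ inv q)

-- Biletters and their lexicographic order

-- A biletter (letter , label) records that a word carries the given letter at the position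
-- occupied by the given label.
Biletter : Set
Biletter = ℕ × ℤ

_≺_ : Biletter → Biletter → Set
(a , x) ≺ (b , y) = a < b ⊎ (a ≡ b × x ℤ.< y)

_⪯_ : Biletter → Biletter → Set
p ⪯ q = ¬ q ≺ p

_≺?_ : (p q : Biletter) → Dec (p ≺ q)
(a , x) ≺? (b , y) with a <? b
... | yes a<b = yes (inj₁ a<b)
... | no a≮b with a ≟ b
...   | no a≢b = no λ { (inj₁ a<b) → a≮b a<b ; (inj₂ (a≡b , _)) → a≢b a≡b }
...   | yes a≡b with x ℤ.<? y
...     | yes x<y = yes (inj₂ (a≡b , x<y))
...     | no x≮y  = no λ { (inj₁ a<b) → a≮b a<b ; (inj₂ (_ , x<y)) → x≮y x<y }

≺-trans : ∀ {p q r} → p ≺ q → q ≺ r → p ≺ r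
≺-trans (inj₁ a<b)         (inj₁ b<c)         = inj₁ (<-trans a<b b<c)
≺-trans (inj₁ a<b)         (inj₂ (refl , _))  = inj₁ a<b
≺-trans (inj₂ (refl , _))  (inj₁ b<c)         = inj₁ b<c
≺-trans (inj₂ (refl , x<y)) (inj₂ (refl , y<z)) = inj₂ (refl , ℤ.<-trans x<y y<z)

≺-irrefl : ∀ {p} → ¬ p ≺ p
≺-irrefl (inj₁ a<a)      = <-irrefl refl a<a
≺-irrefl (inj₂ (_ , x<x)) = ℤ.<-irrefl refl x<x

≺-asym : ∀ {p q} → p ≺ q → ¬ q ≺ p
≺-asym p≺q q≺p = ≺-irrefl (≺-trans p≺q q≺p)

⪯-antisym : ∀ {p q} → p ⪯ q → q ⪯ p → p ≡ q
⪯-antisym {a , x} {b , y} q⊀p p⊀q with <-cmp a b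
... | tri< a<b _ _ = ⊥-elim (p⊀q (inj₁ a<b))
... | tri> _ _ b<a = ⊥-elim (q⊀p (inj₁ b<a))
... | tri≈ _ refl _ with ℤ.<-cmp x y
...   | tri< x<y _ _ = ⊥-elim (p⊀q (inj₂ (refl , x<y)))
...   | tri> _ _ y<x = ⊥-elim (q⊀p (inj₂ (refl , y<x)))
...   | tri≈ _ refl _ = refl

⪯-≺-trans : ∀ {p q r} → p ⪯ q → q ≺ r → p ≺ r
⪯-≺-trans {p} {q} p⪯q q≺r with p ≺? q
... | yes p≺q = ≺-trans p≺q q≺r
... | no q⪯p with ⪯-antisym q⪯p p⪯q
...   | refl = q≺r

≺-⪯-trans : ∀ {p q r} → p ≺ q → q ⪯ r → p ≺ r
≺-⪯-trans {q = q} {r} p≺q q⪯r with q ≺? r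
... | yes q≺r = ≺-trans p≺q q≺r
... | no r⪯q with ⪯-antisym r⪯q q⪯r
...   | refl = p≺q

⪯-trans : ∀ {p q r} → p ⪯ q → q ⪯ r → p ⪯ r
⪯-trans p⪯q q⪯r r≺p = q⪯r (≺-⪯-trans r≺p p⪯q)

insert : Biletter → List Biletter → List Biletter
insert p []      = p ∷ []
insert p (q ∷ l) with q ≺? p
... | yes _ = q ∷ insert p l
... | no _  = p ∷ q ∷ l

insert-≺ : ∀ p q l → q ≺ p → insert p (q ∷ l) ≡ q ∷ insert p l
insert-≺ p q l q≺p with q ≺? p
... | yes _   = refl
... | no q⊀p  = ⊥-elim (q⊀p q≺p)

insert-⪯ : ∀ p q l → p ⪯ q → insert p (q ∷ l) ≡ p ∷ q ∷ l
insert-⪯ p q l p⪯q with q ≺? p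
... | yes q≺p = ⊥-elim (p⪯q q≺p)
... | no _    = refl

-- Insertions commute; this is what makes sorting insensitive to the order of its input.
insert-comm : ∀ p q l → insert p (insert q l) ≡ insert q (insert p l)
insert-comm p q [] with q ≺? p | p ≺? q
... | yes q≺p | yes p≺q = ⊥-elim (≺-asym q≺p p≺q)
... | yes _   | no _    = refl
... | no _    | yes _   = refl
... | no p⪯q  | no q⪯p  with ⪯-antisym p⪯q q⪯p
...   | refl = refl
insert-comm p q (r ∷ l) with r ≺? p | r ≺? q
... | yes r≺p | yes r≺q
  rewrite insert-≺ p r (insert q l) r≺p | insert-≺ q r (insert p l) r≺q
  = cong (r ∷_) (insert-comm p q l)
... | yes r≺p | no q⪯r
  rewrite insert-≺ p q (r ∷ l) (⪯-≺-trans q⪯r r≺p) | insert-≺ p r l r≺p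
        | insert-⪯ q r (insert p l) q⪯r = refl
... | no p⪯r | yes r≺q
  rewrite insert-≺ q p (r ∷ l) (⪯-≺-trans p⪯r r≺q) | insert-≺ q r l r≺q
        | insert-⪯ p r (insert q l) p⪯r = refl
... | no p⪯r | no q⪯r with q ≺? p | p ≺? q
...   | yes q≺p | yes p≺q = ⊥-elim (≺-asym q≺p p≺q)
...   | yes q≺p | no q⪯p  rewrite insert-⪯ p r l p⪯r = refl
...   | no p⪯q  | yes p≺q rewrite insert-⪯ q r l q⪯r = refl
...   | no p⪯q  | no q⪯p  with ⪯-antisym p⪯q q⪯p
...     | refl = refl

sortLex : List Biletter → List Biletter
sortLex []      = []
sortLex (p ∷ l) = insert p (sortLex l)

sortLex-↭-invariant : ∀ {l m} → l ↭ m → sortLex l ≡ sortLex m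
sortLex-↭-invariant ↭-refl        = refl
sortLex-↭-invariant (prep p l↭m)  = cong (insert p) (sortLex-↭-invariant l↭m)
sortLex-↭-invariant (swap {ys = m} p q l↭m) =
  trans (cong (λ t → insert p (insert q t)) (sortLex-↭-invariant l↭m)) (insert-comm p q (sortLex m))
sortLex-↭-invariant (↭-trans l↭m m↭n) = trans (sortLex-↭-invariant l↭m) (sortLex-↭-invariant m↭n)

insert-↭ : ∀ p l → insert p l ↭ p ∷ l
insert-↭ p []      = ↭-refl
insert-↭ p (q ∷ l) with q ≺? p
... | yes _ = ↭-trans (prep q (insert-↭ p l)) (swap q p ↭-refl)
... | no _  = ↭-refl

sortLex-↭ : ∀ l → sortLex l ↭ l
sortLex-↭ []      = ↭-refl
sortLex-↭ (p ∷ l) = ↭-trans (insert-↭ p (sortLex l)) (prep p (sortLex-↭ l))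

Sorted : List Biletter → Set
Sorted = AllPairs _⪯_

insert-sorted : ∀ p l → Sorted l → Sorted (insert p l)
insert-sorted p []      []              = [] ∷ []
insert-sorted p (q ∷ l) (q⪯l ∷ sorted) with q ≺? p
... | yes q≺p = All-resp-↭ (↭-sym (insert-↭ p l)) (≺-asym q≺p ∷ q⪯l) ∷ insert-sorted p l sorted
... | no p⪯q  = (p⪯q ∷ All.map (⪯-trans p⪯q) q⪯l) ∷ q⪯l ∷ sorted

sortLex-sorted : ∀ l → Sorted (sortLex l)
sortLex-sorted []      = []
sortLex-sorted (p ∷ l) = insert-sorted p (sortLex l) (sortLex-sorted l)

sortLex-fixed : ∀ l → Sorted l → sortLex l ≡ l
sortLex-fixed []          _ = refl
sortLex-fixed (p ∷ [])    _ = refl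
sortLex-fixed (p ∷ q ∷ l) ((p⪯q ∷ _) ∷ sorted) rewrite sortLex-fixed (q ∷ l) sorted = insert-⪯ p q l p⪯q

All-filterB : {A : Set} {P : A → Set} (p : A → Bool) {l : List A} → All P l → All P (filterB p l)
All-filterB p []                = []
All-filterB p {x ∷ l} (px ∷ pl) with p x
... | true  = px ∷ All-filterB p pl
... | false = All-filterB p pl

filterB-↭ : {A : Set} (p : A → Bool) {l m : List A} → l ↭ m → filterB p l ↭ filterB p m
filterB-↭ p ↭-refl = ↭-refl
filterB-↭ p (prep x l↭m) with p x
... | true  = prep x (filterB-↭ p l↭m)
... | false = filterB-↭ p l↭m
filterB-↭ p (swap x y l↭m) with p x | p y
... | true  | true  = swap x y (filterB-↭ p l↭m)
... | true  | false = prep x (filterB-↭ p l↭m)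
... | false | true  = prep y (filterB-↭ p l↭m)
... | false | false = filterB-↭ p l↭m
filterB-↭ p (↭-trans l↭m m↭n) = ↭-trans (filterB-↭ p l↭m) (filterB-↭ p m↭n)

Sorted-filterB : (p : Biletter → Bool) → ∀ {l} → Sorted l → Sorted (filterB p l)
Sorted-filterB p []                  = []
Sorted-filterB p {q ∷ l} (q⪯l ∷ sorted) with p q
... | true  = All-filterB p q⪯l ∷ Sorted-filterB p sorted
... | false = Sorted-filterB p sorted

sortLex-filterB : (p : Biletter → Bool) (l : List Biletter) → sortLex (filterB p l) ≡ filterB p (sortLex l)
sortLex-filterB p l = trans (sortLex-↭-invariant (filterB-↭ p (↭-sym (sortLex-↭ l))))
                            (sortLex-fixed _ (Sorted-filterB p (sortLex-sorted l)))

Unique-↭ : {A : Set} {xs ys : List A} → xs ↭ ys → Unique xs → Unique ys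
Unique-↭ {A} xs↭ys = PermutationSetoid.Unique-resp-↭ (setoid A) (↭⇒↭ₛ xs↭ys)

labels-determine : ∀ {P Q : List Biletter} → P ↭ Q → map proj₂ P ≡ map proj₂ Q → Unique (map proj₂ P) → P ≡ Q
labels-determine {[]}            {[]}            _   _ _ = refl
labels-determine {(a , x) ∷ P} {(b , y) ∷ Q} P↭Q e (x∉P ∷ uniq) with ∷-injectiveˡ e
... | refl with ∈-resp-↭ P↭Q (here refl)
...   | here refl = cong ((a , x) ∷_) (labels-determine (drop-∷ P↭Q) (∷-injectiveʳ e) uniq)
...   | there p∈Q = ⊥-elim (All.lookup x∉P (subst (x ∈_) (sym (∷-injectiveʳ e)) (∈-map⁺ proj₂ p∈Q)) refl)

std : List Biletter → List ℤ
std P = map proj₂ (sortLex P)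

-- Cyclic shifts

Rotated : {A : Set} → List A → List A → Set
Rotated {A} x y = Σ (List A) λ a → Σ (List A) λ b → x ≡ a ++ b × y ≡ b ++ a

drop-length-++ : {A : Set} (a b : List A) → drop (length a) (a ++ b) ≡ b
drop-length-++ []      b = refl
drop-length-++ (x ∷ a) b = drop-length-++ a b

take-length-++ : {A : Set} (a b : List A) → take (length a) (a ++ b) ≡ a
take-length-++ []      b = refl
take-length-++ (x ∷ a) b = cong (x ∷_) (take-length-++ a b)

CycShift⇒Rotated : {A : Set} {x y : List A} → CycShift x y → Rotated x y
CycShift⇒Rotated {x = x} (i , _ , y≡) = take i x , drop i x , sym (take++drop≡id i x) , y≡

Rotated⇒CycShift : {A : Set} {x y : List A} → Rotated x y → CycShift x y
Rotated⇒CycShift (a , b , refl , refl) =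
  length a , subst (length a ≤_) (sym (length-++ a)) (m≤m+n (length a) (length b)) ,
  sym (cong₂ _++_ (drop-length-++ a b) (take-length-++ a b))

++-split : {A : Set} (b a c d : List A) → b ++ a ≡ c ++ d →
  (Σ (List A) λ t → c ≡ b ++ t × a ≡ t ++ d) ⊎ (Σ (List A) λ t → b ≡ c ++ t × d ≡ t ++ a)
++-split []      a c       d e = inj₁ (c , refl , e)
++-split (x ∷ b) a []      d e = inj₂ (x ∷ b , refl , sym e)
++-split (x ∷ b) a (y ∷ c) d e with ∷-injectiveˡ e
... | refl with ++-split b a c d (∷-injectiveʳ e)
...   | inj₁ (t , c≡ , a≡) = inj₁ (t , cong (x ∷_) c≡ , a≡)
...   | inj₂ (t , b≡ , d≡) = inj₂ (t , cong (x ∷_) b≡ , d≡)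

Rotated-trans : {A : Set} {x y z : List A} → Rotated x y → Rotated y z → Rotated x z
Rotated-trans (a , b , refl , e) (c , d , e′ , refl) with ++-split b a c d (trans (sym e) e′)
... | inj₁ (t , refl , refl) = t , d ++ b , ++-assoc t d b , sym (++-assoc d b t)
... | inj₂ (t , refl , refl) = a ++ c , t , sym (++-assoc a c t) , ++-assoc t a c

CycShift-refl : {A : Set} (x : List A) → CycShift x x
CycShift-refl x = Rotated⇒CycShift ([] , x , refl , sym (++-identityʳ x))

CycShift-sym : {A : Set} {x y : List A} → CycShift x y → CycShift y x
CycShift-sym s with CycShift⇒Rotated s
... | a , b , x≡ , y≡ = Rotated⇒CycShift (b , a , y≡ , x≡)

CycShift-trans : {A : Set} {x y z : List A} → CycShift x y → CycShift y z → CycShift x z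
CycShift-trans s s′ = Rotated⇒CycShift (Rotated-trans (CycShift⇒Rotated s) (CycShift⇒Rotated s′))

CycShift⇒↭ : {A : Set} {x y : List A} → CycShift x y → x ↭ y
CycShift⇒↭ s with CycShift⇒Rotated s
... | a , b , refl , refl = ++-comm a b

filterB-++ : {A : Set} (p : A → Bool) (a b : List A) → filterB p (a ++ b) ≡ filterB p a ++ filterB p b
filterB-++ p []      b = refl
filterB-++ p (x ∷ a) b with p x
... | true  = cong (x ∷_) (filterB-++ p a b)
... | false = filterB-++ p a b

CycShift-filterB : {A : Set} (p : A → Bool) {x y : List A} → CycShift x y → CycShift (filterB p x) (filterB p y)
CycShift-filterB p s with CycShift⇒Rotated s
... | a , b , refl , refl = Rotated⇒CycShift (filterB p a , filterB p b , filterB-++ p a b , filterB-++ p b a)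

isCycShiftᵇ : List ℤ → List ℤ → Bool
isCycShiftᵇ x y = anyB (λ i → does (≡-dec ℤ._≟_ y (rotate i x))) (upTo (suc (length x)))

isCycShiftᵇ-true : (x y : List ℤ) → isCycShiftᵇ x y ≡ true → CycShift x y
isCycShiftᵇ-true x y h with anyB-upTo⁻ (λ i → does (≡-dec ℤ._≟_ y (rotate i x))) (λ i → i) (suc (length x)) h
... | i , s≤s i≤n , e with ≡-dec ℤ._≟_ y (rotate i x)
...   | yes y≡ = i , i≤n , y≡

isCycShiftᵇ-complete : (x y : List ℤ) → CycShift x y → isCycShiftᵇ x y ≡ true
isCycShiftᵇ-complete x y (i , i≤n , y≡) =
  anyB-upTo⁺ (λ i → does (≡-dec ℤ._≟_ y (rotate i x))) (λ i → i) (suc (length x)) i (s≤s i≤n) decided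
  where
  decided : does (≡-dec ℤ._≟_ y (rotate i x)) ≡ true
  decided with ≡-dec ℤ._≟_ y (rotate i x)
  ... | yes _   = refl
  ... | no y≢ = ⊥-elim (y≢ y≡)

memberᵇ : List ℤ → ℤ → Bool
memberᵇ u x = anyB (λ y → does (x ℤ.≟ y)) u

memberᵇ-true : (u : List ℤ) (x : ℤ) → memberᵇ u x ≡ true → x ∈ u
memberᵇ-true (y ∷ u) x h with x ℤ.≟ y
... | yes refl = here refl
... | no _     = there (memberᵇ-true u x h)

memberᵇ-∈ : (u : List ℤ) (x : ℤ) → x ∈ u → memberᵇ u x ≡ true
memberᵇ-∈ (y ∷ u) x x∈ with x ℤ.≟ y | x∈
... | yes _ | _          = refl
... | no x≢y | here x≡y  = ⊥-elim (x≢y x≡y)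
... | no _   | there x∈u = memberᵇ-∈ u x x∈u

memberᵇ-∉ : (u : List ℤ) (x : ℤ) → x ∉ u → memberᵇ u x ≡ false
memberᵇ-∉ u x x∉u with memberᵇ u x in eq
... | true  = ⊥-elim (x∉u (memberᵇ-true u x eq))
... | false = refl

-- Shuffles and cyclic shuffles

Shuffle⇒↭ : {A : Set} {a b c : List A} → Shuffle a b c → c ↭ a ++ b
Shuffle⇒↭ []        = ↭-refl
Shuffle⇒↭ (left s)  = prep _ (Shuffle⇒↭ s)
Shuffle⇒↭ {a = a} {b = y ∷ b} (right s) = ↭-trans (prep y (Shuffle⇒↭ s)) (↭-sym (shift y a b))

Shuffle-sym : {A : Set} {a b c : List A} → Shuffle a b c → Shuffle b a c
Shuffle-sym []        = []
Shuffle-sym (left s)  = right (Shuffle-sym s)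
Shuffle-sym (right s) = left (Shuffle-sym s)

filterB-Shuffle : (u : List ℤ) {a b c : List ℤ} → Shuffle a b c → All (_∈ u) a → All (_∉ u) b →
  filterB (memberᵇ u) c ≡ a
filterB-Shuffle u [] _ _ = refl
filterB-Shuffle u {x ∷ a} (left s) (x∈u ∷ a⊆u) b∩u=∅ rewrite memberᵇ-∈ u x x∈u =
  cong (x ∷_) (filterB-Shuffle u s a⊆u b∩u=∅)
filterB-Shuffle u {b = y ∷ b} (right s) a⊆u (y∉u ∷ b∩u=∅) rewrite memberᵇ-∉ u y y∉u =
  filterB-Shuffle u s a⊆u b∩u=∅

Shuffle-filterB : (u v o : List ℤ) → Disjoint u v → All (λ x → x ∈ u ⊎ x ∈ v) o →
  Shuffle (filterB (memberᵇ u) o) (filterB (memberᵇ v) o) o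
Shuffle-filterB u v []      d [] = []
Shuffle-filterB u v (x ∷ o) d (inj₁ x∈u ∷ o⊆) rewrite memberᵇ-∈ u x x∈u | memberᵇ-∉ v x (λ x∈v → d (x∈u , x∈v)) =
  left (Shuffle-filterB u v o d o⊆)
Shuffle-filterB u v (x ∷ o) d (inj₂ x∈v ∷ o⊆) rewrite memberᵇ-∈ v x x∈v | memberᵇ-∉ u x (λ x∈u → d (x∈u , x∈v)) =
  right (Shuffle-filterB u v o d o⊆)

IsCycShuffle-sym : (u v o : List ℤ) → IsCycShuffle u v o → IsCycShuffle v u o
IsCycShuffle-sym u v o (w′ , u′ , v′ , o↻ , u↻ , v↻ , sh) = w′ , v′ , u′ , o↻ , v↻ , u↻ , Shuffle-sym sh

IsCycShuffle-shift : (u v r o : List ℤ) → IsCycShuffle u v r → CycShift r o → IsCycShuffle u v o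
IsCycShuffle-shift u v r o (w′ , u′ , v′ , r↻ , u↻ , v↻ , sh) r↻o =
  w′ , u′ , v′ , CycShift-trans (CycShift-sym r↻o) r↻ , u↻ , v↻ , sh

IsCycShuffle⇒↭ : (u v r : List ℤ) → IsCycShuffle u v r → r ↭ u ++ v
IsCycShuffle⇒↭ u v r (w′ , u′ , v′ , r↻ , u↻ , v↻ , sh) =
  ↭-trans (CycShift⇒↭ r↻) (↭-trans (Shuffle⇒↭ sh) (++⁺ (↭-sym (CycShift⇒↭ u↻)) (↭-sym (CycShift⇒↭ v↻))))

IsCycShuffle-restrict : (u v o : List ℤ) → Disjoint u v → IsCycShuffle u v o → CycShift u (filterB (memberᵇ u) o)
IsCycShuffle-restrict u v o d (w′ , u′ , v′ , o↻ , u↻ , v↻ , sh) =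
  CycShift-trans u↻ (subst (λ t → CycShift t (filterB (memberᵇ u) o)) restricted (CycShift-filterB (memberᵇ u) (CycShift-sym o↻)))
  where
  restricted : filterB (memberᵇ u) w′ ≡ u′
  restricted = filterB-Shuffle u sh (All-resp-↭ (CycShift⇒↭ u↻) (All.tabulate (λ x∈u → x∈u)))
    (All.map (λ x∈v x∈u → d (x∈u , x∈v)) (All-resp-↭ (CycShift⇒↭ v↻) (All.tabulate (λ x∈v → x∈v))))

restrict⇒IsCycShuffle : (u v o : List ℤ) → Disjoint u v → o ↭ u ++ v →
  CycShift u (filterB (memberᵇ u) o) → CycShift v (filterB (memberᵇ v) o) → IsCycShuffle u v o
restrict⇒IsCycShuffle u v o d o↭ u↻ v↻ =
  o , filterB (memberᵇ u) o , filterB (memberᵇ v) o , CycShift-refl o , u↻ , v↻ , Shuffle-filterB u v o d o⊆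
  where
  o⊆ : All (λ x → x ∈ u ⊎ x ∈ v) o
  o⊆ = All-resp-↭ (↭-sym o↭) (All.tabulate (∈-++⁻ u))

classCount : List (List ℤ) → List ℤ → ℕ
classCount R o = ∑ (λ r → χ (isCycShiftᵇ r o)) R

classCount-none : (R : List (List ℤ)) (o : List ℤ) → All (λ r → ¬ CycShift r o) R → classCount R o ≡ 0
classCount-none []      o []            = refl
classCount-none (r ∷ R) o (r↻̸o ∷ R↻̸o) with isCycShiftᵇ r o in eq
... | true  = ⊥-elim (r↻̸o (isCycShiftᵇ-true r o eq))
... | false = classCount-none R o R↻̸o

classCount-one : (R : List (List ℤ)) (o : List ℤ) → AllPairs (λ r s → ¬ CycShift r s) R → Any (CycShift o) R →
  classCount R o ≡ 1
classCount-one (r ∷ R) o (r≁R ∷ distinct) (here o↻r) rewrite isCycShiftᵇ-complete r o (CycShift-sym o↻r) =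
  cong suc (classCount-none R o (All.map (λ r≁s s↻o → r≁s (CycShift-trans (CycShift-sym o↻r) (CycShift-sym s↻o))) r≁R))
classCount-one (r ∷ R) o (r≁R ∷ distinct) (there o∈R) with isCycShiftᵇ r o in eq
... | false = classCount-one R o distinct o∈R
... | true with find o∈R
...   | s , s∈R , o↻s = ⊥-elim (All.lookup r≁R s∈R (CycShift-trans (isCycShiftᵇ-true r o eq) o↻s))

transversal-count : (u v : List ℤ) → Disjoint u v → (R : List (List ℤ)) →
  All (IsCycShuffle u v) R → AllPairs (λ r s → ¬ CycShift r s) R → (∀ w → IsCycShuffle u v w → Any (CycShift w) R) →
  (o : List ℤ) → o ↭ u ++ v →
  χ (isCycShiftᵇ u (filterB (memberᵇ u) o)) * χ (isCycShiftᵇ v (filterB (memberᵇ v) o)) ≡ classCount R o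
transversal-count u v d R R⊆ distinct covers o o↭
  with isCycShiftᵇ u (filterB (memberᵇ u) o) in eu | isCycShiftᵇ v (filterB (memberᵇ v) o) in ev
... | true  | true  = sym (classCount-one R o distinct (covers o
                        (restrict⇒IsCycShuffle u v o d o↭ (isCycShiftᵇ-true u _ eu) (isCycShiftᵇ-true v _ ev))))
... | true  | false = sym (classCount-none R o (All.map notShuffle R⊆))
  where
  notShuffle : ∀ {r} → IsCycShuffle u v r → ¬ CycShift r o
  notShuffle {r} r⧢ r↻o with trans (sym (isCycShiftᵇ-complete v _
    (IsCycShuffle-restrict v u o (λ (x∈v , x∈u) → d (x∈u , x∈v)) (IsCycShuffle-sym u v o (IsCycShuffle-shift u v r o r⧢ r↻o))))) ev
  ... | ()
... | false | _     = sym (classCount-none R o (All.map notShuffle R⊆))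
  where
  notShuffle : ∀ {r} → IsCycShuffle u v r → ¬ CycShift r o
  notShuffle {r} r⧢ r↻o with trans (sym (isCycShiftᵇ-complete u _ (IsCycShuffle-restrict u v o d (IsCycShuffle-shift u v r o r⧢ r↻o)))) eu
  ... | ()

rotate-↭ : {A : Set} (i : ℕ) (x : List A) → rotate i x ↭ x
rotate-↭ i x = subst (rotate i x ↭_) (take++drop≡id i x) (++-comm (drop i x) (take i x))

rotate-length : {A : Set} (i : ℕ) (x : List A) → length (rotate i x) ≡ length x
rotate-length i x = ↭-length (rotate-↭ i x)

map-rotate : {A B : Set} (f : A → B) (i : ℕ) (x : List A) → map f (rotate i x) ≡ rotate i (map f x)
map-rotate f i x = trans (map-++ f (drop i x) (take i x)) (sym (cong₂ _++_ (drop-map i x) (take-map i x)))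

rotate-length-self : {A : Set} (x : List A) → rotate (length x) x ≡ rotate 0 x
rotate-length-self x rewrite drop-all (length x) x ≤-refl | take-all (length x) x ≤-refl = sym (++-identityʳ x)

nth-drop : {A : Set} (d : A) (i t : ℕ) (l : List A) → nth d (drop i l) t ≡ nth d l (i + t)
nth-drop d zero    t       l       = refl
nth-drop d (suc i) zero    []      = refl
nth-drop d (suc i) (suc t) []      = refl
nth-drop d (suc i) t       (x ∷ l) = nth-drop d i t l

nth-take : {A : Set} (d : A) (i s : ℕ) (l : List A) → s < i → nth d (take i l) s ≡ nth d l s
nth-take d (suc i) zero    []      _         = refl
nth-take d (suc i) (suc s) []      _         = refl
nth-take d (suc i) zero    (x ∷ l) _         = refl
nth-take d (suc i) (suc s) (x ∷ l) (s≤s s<i) = nth-take d i s l s<i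

nth-++ˡ : {A : Set} (d : A) (a b : List A) (t : ℕ) → t < length a → nth d (a ++ b) t ≡ nth d a t
nth-++ˡ d (x ∷ a) b zero    _         = refl
nth-++ˡ d (x ∷ a) b (suc t) (s≤s t<n) = nth-++ˡ d a b t t<n

nth-++ʳ : {A : Set} (d : A) (a b : List A) (s : ℕ) → nth d (a ++ b) (length a + s) ≡ nth d b s
nth-++ʳ d []      b s = refl
nth-++ʳ d (x ∷ a) b s = nth-++ʳ d a b s

nth-rotate-front : {A : Set} (d : A) (i t : ℕ) (l : List A) → i + t < length l → nth d (rotate i l) t ≡ nth d l (i + t)
nth-rotate-front d i t l i+t<n = trans (nth-++ˡ d (drop i l) (take i l) t t<n-i) (nth-drop d i t l)
  where
  t<n-i : t < length (drop i l)
  t<n-i rewrite length-drop i l = subst (_≤ length l ∸ i) (m+n∸m≡n i (suc t)) (∸-monoˡ-≤ i (subst (_≤ length l) (sym (+-suc i t)) i+t<n))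

nth-rotate-back : {A : Set} (d : A) (i e s : ℕ) (l : List A) → i + e ≡ length l → s < i → nth d (rotate i l) (e + s) ≡ nth d l s
nth-rotate-back d i e s l i+e≡n s<i = begin
  nth d (rotate i l) (e + s)                    ≡⟨ cong (λ m → nth d (rotate i l) (m + s)) e≡ ⟩
  nth d (rotate i l) (length (drop i l) + s)    ≡⟨ nth-++ʳ d (drop i l) (take i l) s ⟩
  nth d (take i l) s                            ≡⟨ nth-take d i s l s<i ⟩
  nth d l s                                     ∎
  where
  open ≡-Reasoning
  e≡ : e ≡ length (drop i l)
  e≡ = trans (sym (m+n∸m≡n i e)) (trans (cong (_∸ i) i+e≡n) (sym (length-drop i l)))

nth-∈ : {A : Set} (d : A) (u : List A) (j : ℕ) → j < length u → nth d u j ∈ u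
nth-∈ d (y ∷ u) zero    _         = here refl
nth-∈ d (y ∷ u) (suc j) (s≤s j<n) = there (nth-∈ d u j j<n)

nth-injective : {A : Set} (d : A) (u : List A) → Unique u → (i j : ℕ) → i < length u → j < length u →
  nth d u i ≡ nth d u j → i ≡ j
nth-injective d (x ∷ u) (x∉u ∷ uniq) zero    zero    _         _         _ = refl
nth-injective d (x ∷ u) (x∉u ∷ uniq) zero    (suc j) _         (s≤s j<n) e = ⊥-elim (All.lookup x∉u (nth-∈ d u j j<n) e)
nth-injective d (x ∷ u) (x∉u ∷ uniq) (suc i) zero    (s≤s i<n) _         e = ⊥-elim (All.lookup x∉u (nth-∈ d u i i<n) (sym e))
nth-injective d (x ∷ u) (x∉u ∷ uniq) (suc i) (suc j) (s≤s i<n) (s≤s j<n) e = cong suc (nth-injective d u uniq i j i<n j<n e)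

chainedᵇ : {A : Set} → (A → A → Bool) → List A → Bool
chainedᵇ R []          = true
chainedᵇ R (x ∷ [])    = true
chainedᵇ R (x ∷ y ∷ m) = R x y ∧ chainedᵇ R (y ∷ m)

chainedᵇ-nth⁻ : {A : Set} (R : A → A → Bool) (d : A) (m : List A) → chainedᵇ R m ≡ true →
  ∀ t → suc t < length m → R (nth d m t) (nth d m (suc t)) ≡ true
chainedᵇ-nth⁻ R d (x ∷ [])    h zero    (s≤s ())
chainedᵇ-nth⁻ R d (x ∷ y ∷ m) h zero    _         = proj₁ (∧-true {R x y} h)
chainedᵇ-nth⁻ R d (x ∷ y ∷ m) h (suc t) (s≤s t<n) = chainedᵇ-nth⁻ R d (y ∷ m) (proj₂ (∧-true {R x y} h)) t t<n

chainedᵇ-nth⁺ : {A : Set} (R : A → A → Bool) (d : A) (m : List A) →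
  (∀ t → suc t < length m → R (nth d m t) (nth d m (suc t)) ≡ true) → chainedᵇ R m ≡ true
chainedᵇ-nth⁺ R d []          h = refl
chainedᵇ-nth⁺ R d (x ∷ [])    h = refl
chainedᵇ-nth⁺ R d (x ∷ y ∷ m) h = ∧-intro (h 0 (s≤s (s≤s z≤n))) (chainedᵇ-nth⁺ R d (y ∷ m) (λ t t<n → h (suc t) (s≤s t<n)))

-- Reading l cyclically, the pair of positions (q, q+1 mod |l|) (0-based) is related by R, unless
-- it is the pair (i-1, i) at which rotate i l cuts l open.
CyclicLink : {A : Set} (R : A → A → Bool) (d : A) (l : List A) (i q : ℕ) → Set
CyclicLink R d l i q =
  (suc q ≡ length l → i ≢ 0 → R (nth d l q) (nth d l 0) ≡ true) ×
  (suc q < length l → suc q ≢ i → R (nth d l q) (nth d l (suc q)) ≡ true)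

m≤n⇒∃m+k≡n : ∀ {m n} → m ≤ n → Σ ℕ λ k → m + k ≡ n
m≤n⇒∃m+k≡n {m} {n} m≤n = n ∸ m , m+[n∸m]≡n m≤n

chained-rotate⇒links : {A : Set} (R : A → A → Bool) (d : A) (l : List A) (i : ℕ) → i < length l →
  (∀ t → suc t < length l → R (nth d (rotate i l) t) (nth d (rotate i l) (suc t)) ≡ true) →
  ∀ q → q < length l → CyclicLink R d l i q
chained-rotate⇒links R d l i i<n chained q q<n = wrapLink , innerLink
  where
  holds : ∀ t → suc t < length l → ∀ {a b} → nth d (rotate i l) t ≡ a → nth d (rotate i l) (suc t) ≡ b → R a b ≡ true
  holds t t<n ea eb = subst₂ (λ a b → R a b ≡ true) ea eb (chained t t<n)
  -- q = |l| - 1 sits at position q - i of the rotation, followed by position 0 of l.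
  wrapLink : suc q ≡ length l → i ≢ 0 → R (nth d l q) (nth d l 0) ≡ true
  wrapLink q+1≡n i≢0 with m≤n⇒∃m+k≡n {i} {q} (≤-pred (subst (i <_) (sym q+1≡n) i<n))
  ... | t , refl = holds t (subst (suc t <_) i+t+1≡n (m<n+m (suc t) (n≢0⇒n>0 i≢0)))
                         (nth-rotate-front d i t l q<n)
                         (trans (cong (nth d (rotate i l)) (sym (+-identityʳ (suc t)))) (nth-rotate-back d i (suc t) 0 l i+t+1≡n (n≢0⇒n>0 i≢0)))
    where
    i+t+1≡n : i + suc t ≡ length l
    i+t+1≡n = trans (+-suc i t) q+1≡n
  -- a link (q, q+1) after the cut (i ≤ q) sits at position q - i of the rotation ...
  linkAfterCut : ∀ t → i + t ≡ q → suc q < length l → R (nth d l q) (nth d l (suc q)) ≡ true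
  linkAfterCut t i+t≡q q+1<n = holds t (≤-<-trans (m≤n+m (suc t) i) (subst (_< length l) (sym i+t+1≡q+1) q+1<n))
    (trans (nth-rotate-front d i t l (subst (_< length l) (sym i+t≡q) q<n)) (cong (nth d l) i+t≡q))
    (trans (nth-rotate-front d i (suc t) l (subst (_< length l) (sym i+t+1≡q+1) q+1<n)) (cong (nth d l) i+t+1≡q+1))
    where
    i+t+1≡q+1 : i + suc t ≡ suc q
    i+t+1≡q+1 = trans (+-suc i t) (cong suc i+t≡q)
  -- ... and one before the cut (q + 1 < i) at position |l| - i + q.
  innerLink : suc q < length l → suc q ≢ i → R (nth d l q) (nth d l (suc q)) ≡ true
  innerLink q+1<n q+1≢i with <-cmp q i
  ... | tri≈ _ q≡i _ = linkAfterCut 0 (trans (+-identityʳ i) (sym q≡i)) q+1<n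
  ... | tri> _ _ i<q with m≤n⇒∃m+k≡n (<⇒≤ i<q)
  ...   | t , i+t≡q = linkAfterCut t i+t≡q q+1<n
  innerLink q+1<n q+1≢i | tri< q<i _ _ with m≤n⇒∃m+k≡n (<⇒≤ i<n)
  ... | e , i+e≡n = holds (e + q)
         (subst (_< length l) (+-suc e q) (subst (e + suc q <_) (trans (+-comm e i) i+e≡n) (+-monoʳ-< e q+1<i)))
         (nth-rotate-back d i e q l i+e≡n q<i)
         (trans (cong (nth d (rotate i l)) (sym (+-suc e q))) (nth-rotate-back d i e (suc q) l i+e≡n q+1<i))
    where
    q+1<i : suc q < i
    q+1<i = ≤∧≢⇒< q<i q+1≢i

links⇒chained-rotate : {A : Set} (R : A → A → Bool) (d : A) (l : List A) (i : ℕ) → i < length l →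
  (∀ q → q < length l → CyclicLink R d l i q) →
  ∀ t → suc t < length l → R (nth d (rotate i l) t) (nth d (rotate i l) (suc t)) ≡ true
links⇒chained-rotate R d l i i<n links t t+1<n with m≤n⇒∃m+k≡n (<⇒≤ i<n)
... | e , i+e≡n with <-cmp (i + suc t) (length l)
-- both positions t, t+1 of the rotation lie in the tail drop i l
...   | tri< i+t+1<n _ _ = subst₂ (λ a b → R a b ≡ true) (sym (nth-rotate-front d i t l i+t<n))
          (sym (trans (nth-rotate-front d i (suc t) l i+t+1<n) (cong (nth d l) (+-suc i t))))
          (proj₂ (links (i + t) i+t<n) q+1<n q+1≢i)
  where
  q+1<n : suc (i + t) < length l
  q+1<n = subst (_< length l) (+-suc i t) i+t+1<n
  i+t<n : i + t < length l
  i+t<n = <-trans (n<1+n (i + t)) q+1<n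
  q+1≢i : suc (i + t) ≢ i
  q+1≢i eq = <⇒≢ (s≤s (m≤m+n i t)) (sym eq)
-- position t is the last of l and t+1 the first
...   | tri≈ _ i+t+1≡n _ = subst₂ (λ a b → R a b ≡ true) (sym (nth-rotate-front d i t l i+t<n))
          (sym (trans (cong (nth d (rotate i l)) (sym (+-identityʳ (suc t)))) (nth-rotate-back d i (suc t) 0 l i+t+1≡n (n≢0⇒n>0 i≢0))))
          (proj₁ (links (i + t) i+t<n) (trans (sym (+-suc i t)) i+t+1≡n) i≢0)
  where
  i+t<n : i + t < length l
  i+t<n = subst (i + t <_) i+t+1≡n (subst (i + t <_) (sym (+-suc i t)) (n<1+n (i + t)))
  i≢0 : i ≢ 0
  i≢0 refl = <-irrefl i+t+1≡n t+1<n
-- both positions lie in the head take i l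
...   | tri> _ _ n<i+t+1 with m≤n⇒∃m+k≡n {e} {t} (≤-pred (+-cancelˡ-< i e (suc t) (subst (_< i + suc t) (sym i+e≡n) n<i+t+1)))
...     | s , refl = subst₂ (λ a b → R a b ≡ true) (sym (nth-rotate-back d i e s l i+e≡n s<i))
          (sym (trans (cong (nth d (rotate i l)) (sym (+-suc e s))) (nth-rotate-back d i e (suc s) l i+e≡n s+1<i)))
          (proj₂ (links s (<-trans s<i i<n)) (<-trans s+1<i i<n) (<⇒≢ s+1<i))
  where
  s+1<i : suc s < i
  s+1<i = +-cancelˡ-< e (suc s) i (subst (_< e + i) (sym (+-suc e s)) (subst (suc (e + s) <_) (trans (sym i+e≡n) (+-comm i e)) t+1<n))
  s<i : s < i
  s<i = <-trans (n<1+n s) s+1<i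

-- The Boolean form of a cyclic link at the 1-based position j = q + 1, as it appears in Defs.cycCond.
linkᵇ : {A : Set} (R : A → A → Bool) (d : A) (l : List A) (N i j : ℕ) → Bool
linkᵇ R d l N i j = (nxt N j ≡ᵇ suc i) ∨ R (at d l j) (at d l (nxt N j))

CyclicLink⇒linkᵇ : {A : Set} (R : A → A → Bool) (d : A) (l : List A) (i q : ℕ) → q < length l →
  CyclicLink R d l i q → linkᵇ R d l (length l) i (suc q) ≡ true
CyclicLink⇒linkᵇ R d l i q q<n (wrapLink , innerLink) with suc q ≡ᵇ length l in last
CyclicLink⇒linkᵇ R d l zero    q q<n (wrapLink , innerLink) | true = refl
CyclicLink⇒linkᵇ R d l (suc i) q q<n (wrapLink , innerLink) | true = wrapLink (≡ᵇ-true _ _ last) (λ ())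
CyclicLink⇒linkᵇ R d l i       q q<n (wrapLink , innerLink) | false with suc q ≡ᵇ i in cut
... | true  = refl
... | false = innerLink (≤∧≢⇒< q<n (≡ᵇ-false _ _ last)) (≡ᵇ-false _ _ cut)

linkᵇ⇒CyclicLink : {A : Set} (R : A → A → Bool) (d : A) (l : List A) (i q : ℕ) → q < length l →
  linkᵇ R d l (length l) i (suc q) ≡ true → CyclicLink R d l i q
linkᵇ⇒CyclicLink R d l i q q<n h with suc q ≡ᵇ length l in last
linkᵇ⇒CyclicLink R d l zero    q q<n h | true =
  (λ _ i≢0 → ⊥-elim (i≢0 refl)) , (λ q+1<n _ → ⊥-elim (<-irrefl (≡ᵇ-true _ _ last) q+1<n))
linkᵇ⇒CyclicLink R d l (suc i) q q<n h | true =
  (λ _ _ → h) , (λ q+1<n _ → ⊥-elim (<-irrefl (≡ᵇ-true _ _ last) q+1<n))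
linkᵇ⇒CyclicLink R d l i       q q<n h | false =
  (λ q+1≡n _ → ⊥-elim (≡ᵇ-false _ _ last q+1≡n)) , (λ _ q+1≢i → ∨-elimˡ (≢⇒≡ᵇ-false (suc q) i q+1≢i) h)

chainedᵇ-rotate : {A : Set} (R : A → A → Bool) (d : A) (l : List A) (N : ℕ) → length l ≡ N → (i : ℕ) → i < N →
  chainedᵇ R (rotate i l) ≡ allB (linkᵇ R d l N i) (range1 N)
chainedᵇ-rotate R d l .(length l) refl i i<n = bool-ext _ _
  (λ h → allB-range⁺ _ (λ q → q) (length l) (λ q q<n → CyclicLink⇒linkᵇ R d l i q q<n
           (chained-rotate⇒links R d l i i<n (λ t t+1<n → chainedᵇ-nth⁻ R d (rotate i l) h t (subst (suc t <_) (sym (rotate-length i l)) t+1<n)) q q<n)))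
  (λ h → chainedᵇ-nth⁺ R d (rotate i l) (λ t t+1<n → links⇒chained-rotate R d l i i<n
           (λ q q<n → linkᵇ⇒CyclicLink R d l i q q<n (allB-range⁻ _ (λ q → q) (length l) h q q<n)) t (subst (suc t <_) (rotate-length i l) t+1<n)))

_≺ᵇ_ : Biletter → Biletter → Bool
p ≺ᵇ q = does (p ≺? q)

≺ᵇ-true : ∀ {p q} → p ≺ᵇ q ≡ true → p ≺ q
≺ᵇ-true {p} {q} h with p ≺? q
... | yes p≺q = p≺q

strictlyChained⇒Sorted : ∀ m → chainedᵇ _≺ᵇ_ m ≡ true → Sorted m
strictlyChained⇒Sorted []          _ = []
strictlyChained⇒Sorted (p ∷ [])    _ = [] ∷ []
strictlyChained⇒Sorted (p ∷ q ∷ m) h =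
  extend (≺ᵇ-true (proj₁ (∧-true {p ≺ᵇ q} h))) (strictlyChained⇒Sorted (q ∷ m) (proj₂ (∧-true {p ≺ᵇ q} h)))
  where
  extend : p ≺ q → Sorted (q ∷ m) → Sorted (p ∷ q ∷ m)
  extend p≺q (q⪯m ∷ sorted) = (≺-asym p≺q ∷ All.map (λ q⪯r r≺p → q⪯r (≺-trans r≺p p≺q)) q⪯m) ∷ q⪯m ∷ sorted

Sorted⇒strictlyChained : ∀ m → Sorted m → Unique (map proj₂ m) → chainedᵇ _≺ᵇ_ m ≡ true
Sorted⇒strictlyChained []          _ _ = refl
Sorted⇒strictlyChained (p ∷ [])    _ _ = refl
Sorted⇒strictlyChained (p ∷ q ∷ m) ((p⪯q ∷ _) ∷ sorted) ((x≢y ∷ _) ∷ uniq) with p ≺? q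
... | yes _   = Sorted⇒strictlyChained (q ∷ m) sorted uniq
... | no q⪯p  = ⊥-elim (x≢y (cong proj₂ (⪯-antisym p⪯q q⪯p)))

module IncreasingRotation (u : List ℤ) (w : List ℕ) (uniq : Unique u) (|w|≡|u| : length w ≡ length u) where

  Z : List Biletter
  Z = zip w u

  labels-Z : map proj₂ Z ≡ u
  labels-Z = labels-zip w u |w|≡|u|
    where
    labels-zip : (w : List ℕ) (u : List ℤ) → length w ≡ length u → map proj₂ (zip w u) ≡ u
    labels-zip []      []      _ = refl
    labels-zip (a ∷ w) (x ∷ u) e = cong (x ∷_) (labels-zip w u (suc-injective e))

  increasingAt : ℕ → Bool
  increasingAt i = chainedᵇ _≺ᵇ_ (rotate i Z)

  -- An increasing rotation is the sorted list, so its labels are the standardization.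
  std-increasing : ∀ i → increasingAt i ≡ true → std Z ≡ rotate i u
  std-increasing i h = begin
    map proj₂ (sortLex Z)           ≡⟨ cong (map proj₂) sortLex-Z ⟩
    map proj₂ (rotate i Z)          ≡⟨ map-rotate proj₂ i Z ⟩
    rotate i (map proj₂ Z)          ≡⟨ cong (rotate i) labels-Z ⟩
    rotate i u                      ∎
    where
    open ≡-Reasoning
    sortLex-Z : sortLex Z ≡ rotate i Z
    sortLex-Z = trans (sortLex-↭-invariant (↭-sym (rotate-↭ i Z))) (sortLex-fixed _ (strictlyChained⇒Sorted _ h))

  atMostOne : ∀ i j → i < length u → j < length u → increasingAt i ≡ true → increasingAt j ≡ true → i ≡ j
  atMostOne i j i<n j<n hi hj = nth-injective (ℤ.+ 0) u uniq i j i<n j<n (begin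
    nth (ℤ.+ 0) u i                      ≡⟨ sym (first i i<n) ⟩
    nth (ℤ.+ 0) (rotate i u) 0           ≡⟨ cong (λ l → nth (ℤ.+ 0) l 0) (trans (sym (std-increasing i hi)) (std-increasing j hj)) ⟩
    nth (ℤ.+ 0) (rotate j u) 0           ≡⟨ first j j<n ⟩
    nth (ℤ.+ 0) u j                      ∎)
    where
    open ≡-Reasoning
    first : ∀ k → k < length u → nth (ℤ.+ 0) (rotate k u) 0 ≡ nth (ℤ.+ 0) u k
    first k k<n = trans (nth-rotate-front (ℤ.+ 0) k 0 u (subst (_< length u) (sym (+-identityʳ k)) k<n))
                        (cong (nth (ℤ.+ 0) u) (+-identityʳ k))

  -- Conversely, if the standardization is the i-th rotation of u then rotate i Z is the sorted list.
  increasing-std : ∀ i → std Z ≡ rotate i u → increasingAt i ≡ true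
  increasing-std i std≡ = subst (λ t → chainedᵇ _≺ᵇ_ t ≡ true) sortLex≡rotate
    (Sorted⇒strictlyChained (sortLex Z) (sortLex-sorted Z) uniqueLabels)
    where
    uniqueLabels : Unique (map proj₂ (sortLex Z))
    uniqueLabels = Unique-↭ (↭-sym (↭-map⁺ proj₂ (sortLex-↭ Z))) (subst Unique (sym labels-Z) uniq)
    sortLex≡rotate : sortLex Z ≡ rotate i Z
    sortLex≡rotate = labels-determine (↭-trans (sortLex-↭ Z) (↭-sym (rotate-↭ i Z)))
      (trans std≡ (sym (trans (map-rotate proj₂ i Z) (cong (rotate i) labels-Z)))) uniqueLabels

  someIncreasing⇔std : 0 < length u → anyB increasingAt (upTo (length u)) ≡ isCycShiftᵇ u (std Z)
  someIncreasing⇔std 0<n = bool-ext _ _ to from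
    where
    to : anyB increasingAt (upTo (length u)) ≡ true → isCycShiftᵇ u (std Z) ≡ true
    to h with anyB-upTo⁻ increasingAt (λ i → i) (length u) h
    ... | i , i<n , inc = isCycShiftᵇ-complete u (std Z) (i , <⇒≤ i<n , std-increasing i inc)
    from : isCycShiftᵇ u (std Z) ≡ true → anyB increasingAt (upTo (length u)) ≡ true
    from h with isCycShiftᵇ-true u (std Z) h
    ... | i , i≤n , std≡ with m≤n⇒m<n∨m≡n i≤n
    ...   | inj₁ i<n  = anyB-upTo⁺ increasingAt (λ i → i) (length u) i i<n (increasing-std i std≡)
    ...   | inj₂ refl = anyB-upTo⁺ increasingAt (λ i → i) (length u) 0 0<n (increasing-std 0 (trans std≡ (rotate-length-self u)))

  count-increasing : 0 < length u → count (λ k → increasingAt (k ∸ 1)) (range1 (length u)) ≡ χ (isCycShiftᵇ u (std Z))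
  count-increasing 0<n = begin
    count (λ k → increasingAt (k ∸ 1)) (map suc (upTo (length u)))  ≡⟨ count-map _ suc (upTo (length u)) ⟩
    count increasingAt (upTo (length u))                           ≡⟨ count-atMostOne increasingAt (λ i → i) (length u) atMostOne ⟩
    χ (anyB increasingAt (upTo (length u)))                         ≡⟨ cong χ (someIncreasing⇔std 0<n) ⟩
    χ (isCycShiftᵇ u (std Z))                                       ∎
    where open ≡-Reasoning

weaklyIncreasing≡chainedᵇ : (m : List ℕ) → weaklyIncreasing m ≡ chainedᵇ _≤ᵇ_ m
weaklyIncreasing≡chainedᵇ []          = refl
weaklyIncreasing≡chainedᵇ (x ∷ [])    = refl
weaklyIncreasing≡chainedᵇ (x ∷ y ∷ m) = cong ((x ≤ᵇ y) ∧_) (weaklyIncreasing≡chainedᵇ (y ∷ m))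

≺ᵇ-descent : (a b : ℕ) (x y : ℤ) → x ≢ y →
  (a ≤ᵇ b) ∧ (if does (y ℤ.<? x) then a <ᵇ b else true) ≡ (a , x) ≺ᵇ (b , y)
≺ᵇ-descent a b x y x≢y with a ≤ᵇ b in e₁ | a <ᵇ b in e₂ | y ℤ.<? x | (a , x) ≺? (b , y)
... | true  | true  | yes _   | yes _ = refl
... | true  | true  | no _    | yes _ = refl
... | _     | true  | _       | no x⊀y = ⊥-elim (x⊀y (inj₁ (≤ᵇ-true (suc a) b e₂)))
... | false | true  | _       | _      = ⊥-elim (≤ᵇ-false a b e₁ (<⇒≤ (≤ᵇ-true (suc a) b e₂)))
... | _     | false | _       | yes (inj₁ a<b) = ⊥-elim (≤ᵇ-false (suc a) b e₂ a<b)
... | true  | false | yes y<x | yes (inj₂ (_ , x<y)) = ⊥-elim (ℤ.<-asym x<y y<x)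
... | true  | false | yes _   | no _   = refl
... | true  | false | no _    | yes _  = refl
... | true  | false | no y≮x  | no x⊀y with ℤ.<-cmp x y
...   | tri< x<y _ _ = ⊥-elim (x⊀y (inj₂ (≤-antisym (≤ᵇ-true a b e₁) (≮⇒≥ (≤ᵇ-false (suc a) b e₂)) , x<y)))
...   | tri≈ _ x≡y _ = ⊥-elim (x≢y x≡y)
...   | tri> _ _ y<x = ⊥-elim (y≮x y<x)
≺ᵇ-descent a b x y x≢y | false | false | _     | yes (inj₂ (refl , _)) = ⊥-elim (≤ᵇ-false a b e₁ ≤-refl)
≺ᵇ-descent a b x y x≢y | false | false | yes _ | no _ = refl
≺ᵇ-descent a b x y x≢y | false | false | no _  | no _ = refl

-- The same, for a cyclic link that may be the cut (c = true), where no condition is imposed.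
≺ᵇ-descent-link : (a b : ℕ) (x y : ℤ) (c des : Bool) → des ≡ does (y ℤ.<? x) → (c ≡ false → x ≢ y) →
  (c ∨ (a ≤ᵇ b)) ∧ (if des ∧ not c then a <ᵇ b else true) ≡ c ∨ (a , x) ≺ᵇ (b , y)
≺ᵇ-descent-link a b x y true  true  _    _   = refl
≺ᵇ-descent-link a b x y true  false _    _   = refl
≺ᵇ-descent-link a b x y false _     refl x≢y rewrite ∧-identityʳ (does (y ℤ.<? x)) = ≺ᵇ-descent a b x y (x≢y refl)

anyB-≡ᵇ-filterB : (p : ℕ → Bool) (j : ℕ) (xs : List ℕ) → anyB (λ x → x ≡ᵇ j) (filterB p xs) ≡ p j ∧ anyB (λ x → x ≡ᵇ j) xs
anyB-≡ᵇ-filterB p j []       = sym (∧-zeroʳ (p j))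
anyB-≡ᵇ-filterB p j (x ∷ xs) with p x in px
... | true with x ≡ᵇ j in x≡j
...   | true rewrite subst (λ z → p z ≡ true) (≡ᵇ-true x j x≡j) px = refl
...   | false = anyB-≡ᵇ-filterB p j xs
anyB-≡ᵇ-filterB p j (x ∷ xs) | false with x ≡ᵇ j in x≡j
...   | false = anyB-≡ᵇ-filterB p j xs
...   | true  = trans (anyB-≡ᵇ-filterB p j xs) (trans (cong (_∧ anyB (λ x → x ≡ᵇ j) xs) pj≡false) (sym (cong (_∧ true) pj≡false)))
  where
  pj≡false : p j ≡ false
  pj≡false = subst (λ z → p z ≡ false) (≡ᵇ-true x j x≡j) px

∈-cDes : (u : List ℤ) (q : ℕ) → q < length u →
  anyB (λ x → x ≡ᵇ suc q) (cDes u) ≡ does (at (ℤ.+ 0) u (nxt (length u) (suc q)) ℤ.<? at (ℤ.+ 0) u (suc q))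
∈-cDes (x ∷ [])     (suc q) (s≤s ())
∈-cDes (x ∷ [])     zero    _ with x ℤ.<? x
... | yes x<x = ⊥-elim (ℤ.<-irrefl refl x<x)
... | no _    = refl
∈-cDes u@(x ∷ y ∷ r) q q<n = begin
  anyB (λ j → j ≡ᵇ suc q) (filterB descentAt (range1 (length u)))   ≡⟨ anyB-≡ᵇ-filterB descentAt (suc q) (range1 (length u)) ⟩
  descentAt (suc q) ∧ anyB (λ j → j ≡ᵇ suc q) (range1 (length u))  ≡⟨ cong (descentAt (suc q) ∧_) inRange ⟩
  descentAt (suc q) ∧ true                                         ≡⟨ ∧-identityʳ (descentAt (suc q)) ⟩
  descentAt (suc q)                                                ∎
  where
  open ≡-Reasoning
  descentAt : ℕ → Bool
  descentAt i = does (at (ℤ.+ 0) u (nxt (length u) i) ℤ.<? at (ℤ.+ 0) u i)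
  anyB-map : (p : ℕ → Bool) (xs : List ℕ) → anyB p (map suc xs) ≡ anyB (λ x → p (suc x)) xs
  anyB-map p []       = refl
  anyB-map p (x ∷ xs) = cong (p (suc x) ∨_) (anyB-map p xs)
  inRange : anyB (λ j → j ≡ᵇ suc q) (range1 (length u)) ≡ true
  inRange = trans (anyB-map (λ j → j ≡ᵇ suc q) (upTo (length u)))
                  (anyB-upTo⁺ (λ j → suc j ≡ᵇ suc q) (λ j → j) (length u) q q<n (≡ᵇ-refl q q refl))

distinct-link : (u : List ℤ) → Unique u → (q i : ℕ) → q < length u → i < length u →
  (nxt (length u) (suc q) ≡ᵇ suc i) ≡ false → at (ℤ.+ 0) u (suc q) ≢ at (ℤ.+ 0) u (nxt (length u) (suc q))
distinct-link u uniq q i q<n i<n notCut with suc q ≡ᵇ length u in last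
... | true = λ e → q≢0 (nth-injective (ℤ.+ 0) u uniq q 0 q<n (≤-<-trans z≤n q<n) e)
  where
  -- here the link is (q, 0); it is not the cut, so i ≠ 0, and i < |u| = q + 1, so q ≠ 0
  notFirst : ∀ i → i < length u → (1 ≡ᵇ suc i) ≡ false → 1 ≢ length u
  notFirst zero     _   ()
  notFirst (suc i′) i<n _  1≡n with subst (suc i′ <_) (sym 1≡n) i<n
  ... | s≤s ()
  q≢0 : q ≢ 0
  q≢0 refl = notFirst i i<n notCut (≡ᵇ-true _ _ last)
... | false = λ e → <-irrefl refl
  (subst (_< suc q) (nth-injective (ℤ.+ 0) u uniq q (suc q) q<n (≤∧≢⇒< q<n (≡ᵇ-false _ _ last)) e) ≤-refl)

at-zip : (w : List ℕ) (u : List ℤ) → length w ≡ length u → (j : ℕ) →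
  at (0 , ℤ.+ 0) (zip w u) j ≡ (at 0 w j , at (ℤ.+ 0) u j)
at-zip w u e j = nth-zip w u e (j ∸ 1)
  where
  nth-zip : (w : List ℕ) (u : List ℤ) → length w ≡ length u → (q : ℕ) → nth (0 , ℤ.+ 0) (zip w u) q ≡ (nth 0 w q , nth (ℤ.+ 0) u q)
  nth-zip []      []      _ q       = refl
  nth-zip (a ∷ w) (x ∷ u) _ zero    = refl
  nth-zip (a ∷ w) (x ∷ u) e (suc q) = nth-zip w u (suc-injective e) q

cycCond≡increasing : (u : List ℤ) → Unique u → (w : List ℕ) → length w ≡ length u → (i : ℕ) → i < length u →
  cycCond (length u) (cDes u) w (suc i) ≡ chainedᵇ _≺ᵇ_ (rotate i (zip w u))
cycCond≡increasing u uniq w |w|≡N i i<N = begin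
  weaklyIncreasing (rotate i w) ∧ allB descentsStrict (range1 N)
    ≡⟨ cong (_∧ allB descentsStrict (range1 N)) (trans (weaklyIncreasing≡chainedᵇ (rotate i w)) (chainedᵇ-rotate _≤ᵇ_ 0 w N |w|≡N i i<N)) ⟩
  allB (linkᵇ _≤ᵇ_ 0 w N i) (range1 N) ∧ allB descentsStrict (range1 N)
    ≡⟨ allB-∧ (linkᵇ _≤ᵇ_ 0 w N i) descentsStrict (range1 N) ⟩
  allB (λ j → linkᵇ _≤ᵇ_ 0 w N i j ∧ descentsStrict j) (range1 N)
    ≡⟨ allB-cong-range _ _ (λ q → q) N linkwise ⟩
  allB (linkᵇ _≺ᵇ_ (0 , ℤ.+ 0) (zip w u) N i) (range1 N)
    ≡⟨ sym (chainedᵇ-rotate _≺ᵇ_ (0 , ℤ.+ 0) (zip w u) N (trans (length-zipWith-≡ _,_ w u |w|≡N) |w|≡N) i i<N) ⟩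
  chainedᵇ _≺ᵇ_ (rotate i (zip w u))
    ∎
  where
  open ≡-Reasoning
  N = length u
  cut : ℕ → Bool
  cut j = nxt N j ≡ᵇ suc i
  descentsStrict : ℕ → Bool
  descentsStrict j = if anyB (λ x → x ≡ᵇ j) (cDes u) ∧ not (cut j) then at 0 w j <ᵇ at 0 w (nxt N j) else true
  linkwise : ∀ q → q < N → linkᵇ _≤ᵇ_ 0 w N i (suc q) ∧ descentsStrict (suc q) ≡ linkᵇ _≺ᵇ_ (0 , ℤ.+ 0) (zip w u) N i (suc q)
  linkwise q q<N = begin
    linkᵇ _≤ᵇ_ 0 w N i (suc q) ∧ descentsStrict (suc q)
      ≡⟨ ≺ᵇ-descent-link (at 0 w (suc q)) (at 0 w (nxt N (suc q))) (at (ℤ.+ 0) u (suc q)) (at (ℤ.+ 0) u (nxt N (suc q)))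
           (cut (suc q)) _ (∈-cDes u q q<N) (distinct-link u uniq q i q<N i<N) ⟩
    cut (suc q) ∨ (at 0 w (suc q) , at (ℤ.+ 0) u (suc q)) ≺ᵇ (at 0 w (nxt N (suc q)) , at (ℤ.+ 0) u (nxt N (suc q)))
      ≡⟨ cong₂ (λ p p′ → cut (suc q) ∨ p ≺ᵇ p′) (sym (at-zip w u |w|≡N (suc q))) (sym (at-zip w u |w|≡N (nxt N (suc q)))) ⟩
    linkᵇ _≺ᵇ_ (0 , ℤ.+ 0) (zip w u) N i (suc q)
      ∎

inClass : List ℤ → List Biletter → ℕ
inClass x P = χ (isCycShiftᵇ x (std P))

inClass-↭ : (x : List ℤ) → PermInvariant (inClass x)
inClass-↭ x P↭Q = cong (λ l → χ (isCycShiftᵇ x (map proj₂ l))) (sortLex-↭-invariant P↭Q)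

Fcyc-coefficient : (u : List ℤ) → Unique u → (β : List ℕ) (L : ℕ) → length β ≡ L →
  Fcyc (length u) (cDes u) β ≡ ∑ (λ w → χ (hasContent β w) * inClass u (zip w u)) (words (length u) L)
Fcyc-coefficient []        _    β .(length β) refl =
  trans (cong χ (sym (hasContent-[] β))) (sym (trans (+-identityʳ _) (*-identityʳ _)))
Fcyc-coefficient u@(_ ∷ _) uniq β .(length β) refl = begin
  ∑ (λ w → count (cycCond N (cDes u) w) (range1 N)) (filterB (hasContent β) (words N (length β)))
    ≡⟨ ∑-filterB (hasContent β) _ (words N (length β)) ⟩
  ∑ (λ w → if hasContent β w then count (cycCond N (cDes u) w) (range1 N) else 0) (words N (length β))
    ≡⟨ ∑-words-cong N (length β) (λ w |w|≡N → trans (if-χ (hasContent β w) _) (cong (χ (hasContent β w) *_) (countRotations w |w|≡N))) ⟩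
  ∑ (λ w → χ (hasContent β w) * inClass u (zip w u)) (words N (length β))
    ∎
  where
  open ≡-Reasoning
  N = length u
  countRotations : ∀ w → length w ≡ N → count (cycCond N (cDes u) w) (range1 N) ≡ χ (isCycShiftᵇ u (std (zip w u)))
  countRotations w |w|≡N =
    trans (count-cong-range (cycCond N (cDes u) w) (λ k → chainedᵇ _≺ᵇ_ (rotate (k ∸ 1) (zip w u))) (λ i → i) N
                            (λ i i<N → cycCond≡increasing u uniq w |w|≡N i i<N))
          (IncreasingRotation.count-increasing u w uniq |w|≡N (s≤s z≤n))

restrictTo : List ℤ → List Biletter → List Biletter
restrictTo u = filterB (λ p → memberᵇ u (proj₂ p))

std-restrictTo : (u : List ℤ) (P : List Biletter) → std (restrictTo u P) ≡ filterB (memberᵇ u) (std P)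
std-restrictTo u P = trans (cong (map proj₂) (sortLex-filterB (λ p → memberᵇ u (proj₂ p)) P)) (labels-filterB (sortLex P))
  where
  labels-filterB : (l : List Biletter) → map proj₂ (restrictTo u l) ≡ filterB (memberᵇ u) (map proj₂ l)
  labels-filterB []            = refl
  labels-filterB ((a , x) ∷ l) with memberᵇ u x
  ... | true  = cong (x ∷_) (labels-filterB l)
  ... | false = labels-filterB l

zip-++ : {A B : Set} (w₁ w₂ : List A) (x₁ x₂ : List B) → length w₁ ≡ length x₁ → zip (w₁ ++ w₂) (x₁ ++ x₂) ≡ zip w₁ x₁ ++ zip w₂ x₂
zip-++ []       w₂ []       x₂ _ = refl
zip-++ (a ∷ w₁) w₂ (x ∷ x₁) x₂ e = cong ((a , x) ∷_) (zip-++ w₁ w₂ x₁ x₂ (suc-injective e))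

restrictTo-zip : (u v : List ℤ) → Disjoint u v → (w₁ w₂ : List ℕ) → length w₁ ≡ length u →
  restrictTo u (zip (w₁ ++ w₂) (u ++ v)) ≡ zip w₁ u × restrictTo v (zip (w₁ ++ w₂) (u ++ v)) ≡ zip w₂ v
restrictTo-zip u v d w₁ w₂ |w₁|≡|u| rewrite zip-++ w₁ w₂ u v |w₁|≡|u|
                                          | filterB-++ (λ p → memberᵇ u (proj₂ p)) (zip w₁ u) (zip w₂ v)
                                          | filterB-++ (λ p → memberᵇ v (proj₂ p)) (zip w₁ u) (zip w₂ v) =
  trans (cong₂ _++_ (keep u (zip w₁ u) (labels∈ w₁ u)) (discard u (zip w₂ v) (All.map (λ x∈v x∈u → d (x∈u , x∈v)) (labels∈ w₂ v))))
        (++-identityʳ (zip w₁ u)) ,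
  cong₂ _++_ (discard v (zip w₁ u) (All.map (λ x∈u x∈v → d (x∈u , x∈v)) (labels∈ w₁ u))) (keep v (zip w₂ v) (labels∈ w₂ v))
  where
  labels∈ : (w : List ℕ) (x : List ℤ) → All (λ p → proj₂ p ∈ x) (zip w x)
  labels∈ []      x       = []
  labels∈ (a ∷ w) []      = []
  labels∈ (a ∷ w) (y ∷ x) = here refl ∷ All.map there (labels∈ w x)
  keep : (u : List ℤ) (l : List Biletter) → All (λ p → proj₂ p ∈ u) l → restrictTo u l ≡ l
  keep u []            []          = refl
  keep u ((a , x) ∷ l) (x∈u ∷ l∈u) rewrite memberᵇ-∈ u x x∈u = cong ((a , x) ∷_) (keep u l l∈u)
  discard : (u : List ℤ) (l : List Biletter) → All (λ p → proj₂ p ∉ u) l → restrictTo u l ≡ []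
  discard u []            []          = refl
  discard u ((a , x) ∷ l) (x∉u ∷ l∉u) rewrite memberᵇ-∉ u x x∉u = discard u l l∉u

letters-zip : {A B : Set} (w : List A) (x : List B) → length w ≡ length x → map proj₁ (zip w x) ≡ w
letters-zip []      []      _ = refl
letters-zip (a ∷ w) (b ∷ x) e = cong (a ∷_) (letters-zip w x (suc-injective e))

labels-zip : {A B : Set} (w : List A) (x : List B) → length w ≡ length x → map proj₂ (zip w x) ≡ x
labels-zip []      []      _ = refl
labels-zip (a ∷ w) (b ∷ x) e = cong (b ∷_) (labels-zip w x (suc-injective e))

-- The two sides of the theorem, coefficient by coefficient

module CoefficientOf (u v : List ℤ) (uniq-u : Unique u) (uniq-v : Unique v) (disjoint : Disjoint u v) (α : List ℕ) where

  L = length α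
  c = u ++ v

  -- The common value of the coefficient of x^α on both sides: words w labelled by c = u ++ v,
  -- weighted by [content w = α]·[std P|u ∈ [u]]·[std P|v ∈ [v]] for P = zip w c.
  integrand : List ℕ → ℕ
  integrand w = χ (hasContent α w) * (inClass u (restrictTo u (zip w c)) * inClass v (restrictTo v (zip w c)))

  shuffleCount : ℕ
  shuffleCount = ∑ integrand (words (length u + length v) L)

  integrand-split : ∀ w₁ w₂ → length w₁ ≡ length u →
    integrand (w₁ ++ w₂) ≡ χ (hasContent α (w₁ ++ w₂)) * (inClass u (zip w₁ u) * inClass v (zip w₂ v))
  integrand-split w₁ w₂ |w₁|≡|u| with restrictTo-zip u v disjoint w₁ w₂ |w₁|≡|u|
  ... | restrict-u , restrict-v = cong (λ t → χ (hasContent α (w₁ ++ w₂)) * t) (cong₂ _*_ (cong (inClass u) restrict-u) (cong (inClass v) restrict-v))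

  -- A term of the product side after expanding both factors by (★): w₁ of content β labelled by u,
  -- and w₂ of content α - β labelled by v.
  productTerm : List ℕ → List ℕ → List ℕ → ℕ
  productTerm β w₁ w₂ = (χ (hasContent β w₁) * inClass u (zip w₁ u)) * (χ (hasContent (zipWith _∸_ α β) w₂) * inClass v (zip w₂ v))

  expand-factors : ∀ β → length β ≡ L →
    Fcyc (length u) (cDes u) β * Fcyc (length v) (cDes v) (zipWith _∸_ α β)
      ≡ ∑ (λ w₁ → ∑ (λ w₂ → productTerm β w₁ w₂) (words (length v) L)) (words (length u) L)
  expand-factors β |β|≡L =
    trans (cong₂ _*_ (Fcyc-coefficient u uniq-u β L |β|≡L)
                     (Fcyc-coefficient v uniq-v (zipWith _∸_ α β) L (length-zipWith-≡ _∸_ α β (sym |β|≡L))))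
          (∑-product _ _ (words (length u) L) (words (length v) L))

  sum-over-splittings : ∀ w₁ w₂ →
    ∑ (λ β → productTerm β w₁ w₂) (below α) ≡ χ (hasContent α (w₁ ++ w₂)) * (inClass u (zip w₁ u) * inClass v (zip w₂ v))
  sum-over-splittings w₁ w₂ = begin
    ∑ (λ β → productTerm β w₁ w₂) (below α)
      ≡⟨ ∑-cong (below α) (λ β → [m*n]*[o*p]≡[m*o]*[n*p] (χ (hasContent β w₁)) Iu (χ (hasContent (zipWith _∸_ α β) w₂)) Iv) ⟩
    ∑ (λ β → (χ (hasContent β w₁) * χ (hasContent (zipWith _∸_ α β) w₂)) * (Iu * Iv)) (below α)
      ≡⟨ ∑-*ʳ (Iu * Iv) (λ β → χ (hasContent β w₁) * χ (hasContent (zipWith _∸_ α β) w₂)) (below α) ⟩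
    ∑ (λ β → χ (hasContent β w₁) * χ (hasContent (zipWith _∸_ α β) w₂)) (below α) * (Iu * Iv)
      ≡⟨ cong (_* (Iu * Iv)) (content-convolution α w₁ w₂) ⟩
    χ (hasContent α (w₁ ++ w₂)) * (Iu * Iv)
      ∎
    where
    open ≡-Reasoning
    Iu = inClass u (zip w₁ u)
    Iv = inClass v (zip w₂ v)

  product-side : (Fcyc (length u) (cDes u) *ˢ Fcyc (length v) (cDes v)) α ≡ shuffleCount
  product-side = begin
    ∑ (λ β → Fcyc a (cDes u) β * Fcyc b (cDes v) (zipWith _∸_ α β)) (below α)
      ≡⟨ ∑-congᴬ (All.map (λ {β} → expand-factors β) (below-length α)) ⟩
    ∑ (λ β → ∑ (λ w₁ → ∑ (λ w₂ → productTerm β w₁ w₂) (words b L)) (words a L)) (below α)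
      ≡⟨ ∑-swap (λ β w₁ → ∑ (λ w₂ → productTerm β w₁ w₂) (words b L)) (below α) (words a L) ⟩
    ∑ (λ w₁ → ∑ (λ β → ∑ (λ w₂ → productTerm β w₁ w₂) (words b L)) (below α)) (words a L)
      ≡⟨ ∑-cong (words a L) (λ w₁ → ∑-swap (λ β w₂ → productTerm β w₁ w₂) (below α) (words b L)) ⟩
    ∑ (λ w₁ → ∑ (λ w₂ → ∑ (λ β → productTerm β w₁ w₂) (below α)) (words b L)) (words a L)
      ≡⟨ ∑-words-cong a L (λ w₁ |w₁|≡a → ∑-cong (words b L) (λ w₂ →
           trans (sum-over-splittings w₁ w₂) (sym (integrand-split w₁ w₂ |w₁|≡a)))) ⟩
    ∑ (λ w₁ → ∑ (λ w₂ → integrand (w₁ ++ w₂)) (words b L)) (words a L)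
      ≡⟨ sym (∑-words-+ a b L integrand) ⟩
    shuffleCount
      ∎
    where
    open ≡-Reasoning
    a = length u
    b = length v

  weighted : List ℤ → List Biletter → ℕ
  weighted r P = χ (hasContent α (map proj₁ P)) * inClass r P

  weighted-↭ : (r : List ℤ) → PermInvariant (weighted r)
  weighted-↭ r P↭Q = cong₂ _*_ (cong χ (hasContent-↭ α (↭-map⁺ proj₁ P↭Q))) (inClass-↭ r P↭Q)

  relabel : ∀ r → IsCycShuffle u v r →
    Fcyc (length r) (cDes r) α ≡ ∑ (λ w → weighted r (zip w c)) (words (length c) L)
  relabel r r⧢ = begin
    Fcyc (length r) (cDes r) α
      ≡⟨ Fcyc-coefficient r (Unique-↭ (↭-sym r↭c) (Unique.++⁺ uniq-u uniq-v disjoint)) α L refl ⟩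
    ∑ (λ w → χ (hasContent α w) * inClass r (zip w r)) (words (length r) L)
      ≡⟨ ∑-words-cong (length r) L (λ w |w|≡|r| → cong (λ t → χ (hasContent α t) * inClass r (zip w r)) (sym (letters-zip w r |w|≡|r|))) ⟩
    ∑ (λ w → weighted r (zip w r)) (words (length r) L)
      ≡⟨ ∑-relabel L (weighted r) (weighted-↭ r) r↭c ⟩
    ∑ (λ w → weighted r (zip w c)) (words (length c) L)
      ∎
    where
    open ≡-Reasoning
    r↭c : r ↭ c
    r↭c = IsCycShuffle⇒↭ u v r r⧢

  transversal-side : (R : List (List ℤ)) → All (IsCycShuffle u v) R → AllPairs (λ r s → ¬ CycShift r s) R →
    (∀ w → IsCycShuffle u v w → Any (CycShift w) R) →
    sumˢ (map (λ w → Fcyc (length w) (cDes w)) R) α ≡ shuffleCount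
  transversal-side R R⧢ distinct covers = begin
    sumˢ (map (λ w → Fcyc (length w) (cDes w)) R) α
      ≡⟨ sumˢ-map (λ w → Fcyc (length w) (cDes w)) R α ⟩
    ∑ (λ r → Fcyc (length r) (cDes r) α) R
      ≡⟨ ∑-congᴬ (All.map (λ {r} → relabel r) R⧢) ⟩
    ∑ (λ r → ∑ (λ w → weighted r (zip w c)) (words (length c) L)) R
      ≡⟨ ∑-swap (λ r w → weighted r (zip w c)) R (words (length c) L) ⟩
    ∑ (λ w → ∑ (λ r → weighted r (zip w c)) R) (words (length c) L)
      ≡⟨ ∑-words-cong (length c) L countClasses ⟩
    ∑ integrand (words (length c) L)
      ≡⟨ cong (λ n → ∑ integrand (words n L)) (length-++ u) ⟩
    shuffleCount
      ∎
    where
    open ≡-Reasoning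
    countClasses : ∀ w → length w ≡ length c → ∑ (λ r → weighted r (zip w c)) R ≡ integrand w
    countClasses w |w|≡|c| = begin
      ∑ (λ r → χ (hasContent α (map proj₁ P)) * inClass r P) R
        ≡⟨ ∑-*ˡ (χ (hasContent α (map proj₁ P))) (λ r → inClass r P) R ⟩
      χ (hasContent α (map proj₁ P)) * classCount R (std P)
        ≡⟨ cong₂ (λ t n → χ (hasContent α t) * n) (letters-zip w c |w|≡|c|)
                 (sym (transversal-count u v disjoint R R⧢ distinct covers (std P) std↭c)) ⟩
      χ (hasContent α w) * (χ (isCycShiftᵇ u (filterB (memberᵇ u) (std P))) * χ (isCycShiftᵇ v (filterB (memberᵇ v) (std P))))
        ≡⟨ cong (λ t → χ (hasContent α w) * t)
                (sym (cong₂ (λ s t → χ (isCycShiftᵇ u s) * χ (isCycShiftᵇ v t)) (std-restrictTo u P) (std-restrictTo v P))) ⟩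
      integrand w
        ∎
      where
      P = zip w c
      std↭c : std P ↭ c
      std↭c = subst (std P ↭_) (labels-zip w c |w|≡|c|) (↭-map⁺ proj₂ (sortLex-↭ P))

theorem3p22 : (u v : List ℤ) → Unique u → Unique v → Disjoint u v →
    (R : List (List ℤ)) →
    All (IsCycShuffle u v) R →
    AllPairs (λ r s → ¬ CycShift r s) R →
    (∀ w → IsCycShuffle u v w → Any (CycShift w) R) →
    Fcyc (length u) (cDes u) *ˢ Fcyc (length v) (cDes v)
      ≈ˢ sumˢ (map (λ w → Fcyc (length w) (cDes w)) R)
theorem3p22 u v uniq-u uniq-v disjoint R R⧢ distinct covers α =
  trans product-side (sym (transversal-side R R⧢ distinct covers))
  where open CoefficientOf u v uniq-u uniq-v disjoint α
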